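{- Let $p>2$ be a prime, let $t$ be a positive divisor of $p-1$ and let $k$ be an integer with $1<k\le(p/2)^{1/2}$. Put $r_1(k)=\left\lfloor \frac{\log(p/2)}{2\log k}\right\rfloor$ and $s=s_1(k,t)=\max\left\{s'\in\mathbb{Z}_{\ge0}~:~\binom{r_1(k)+s'}{s'}\le t\right\}$. Then $$\#\{|x|~:~x\in V(k,t,1)\}\le\tilde\Phi(k,s).$$
   Context: $\mathbb{F}_p$ is the field of residues modulo $p$. For $x\in\mathbb{F}_p$, the integer height is $|x|=\min\{|a|~:~a\in\mathbb{Z},\ a\equiv x\pmod p\}$ and the rational height is $\|x\|=\min\{\max(|a|,b)~:~a\in\mathbb{Z},\ b\in\mathbb{N},\ a\equiv bx \pmod p\}$. For $t\mid p-1$, $G$ is the unique subgroup of $\mathbb{F}_p^*$ of order $t$ and $V(k,t,1)=\{x\in G~:~\|x\|\le k\}$. $\Psi(x,y)$ is the number of positive integers $n\le x$ all of whose prime factors are at most $y$; $p_j$ is the $j$-th prime ($p_1=2$), with the convention $\Psi(x,p_0)=1$ for $x\ge 1$. For $s\in\mathbb{N}$, $\tilde\Phi(k,s)=\sum_{i=0}^{s}\binom{s}{i}\Psi(k,p_i)\Psi(k,p_{s-i})$, and $\tilde\Phi(k,0)=1$. -}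

module Defs where

open import Data.Bool using (Bool; true; false; _∧_; _∨_; not; if_then_else_)
open import Data.Nat using (ℕ; zero; suc; _+_; _*_; _∸_; _^_; _≤_; _<_; _⊓_; _≤?_)
open import Data.Nat.Primality using (Prime; prime?)
open import Data.Nat.Divisibility using (_∣?_; _∣_)
open import Data.Nat.Combinatorics using (_C_)
open import Data.Integer as ℤ using (ℤ; +_)
open import Data.Integer.Divisibility as ℤD using ()
open import Data.List using (List; upTo; map)
open import Data.Bool.ListAction using (and)

open import Data.Product using (Σ; ∃; _×_)
open import Relation.Nullary.Decidable using (⌊_⌋)
open import Relation.Binary.PropositionalEquality using (_≡_)

count : (ℕ → Bool) → ℕ → ℕ
count f zero = 0
count f (suc n) = (if f (suc n) then 1 else 0) + count f n

-- all prime factors of n are ≤ y  (only primes q ≤ n can divide n ≥ 1)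
smoothᵇ : ℕ → ℕ → Bool
smoothᵇ y n = and (map (λ q → not (⌊ prime? q ⌋ ∧ ⌊ q ∣? n ⌋) ∨ ⌊ q ≤? y ⌋) (upTo (suc n)))

Ψ : ℕ → ℕ → ℕ
Ψ x y = count (smoothᵇ y) x

primeCount : ℕ → ℕ
primeCount = count (λ m → ⌊ prime? m ⌋)

-- P enumerates the primes: P j is the j-th prime p_j for j ≥ 1 (p_1 = 2)
IsPrimeEnum : (ℕ → ℕ) → Set
IsPrimeEnum P = ∀ j → 1 ≤ j → Prime (P j) × primeCount (P j) ≡ j

Ψp : (ℕ → ℕ) → ℕ → ℕ → ℕ
Ψp P x zero = 1
Ψp P x (suc i) = Ψ x (P (suc i))

sumTo : ℕ → (ℕ → ℕ) → ℕ
sumTo zero f = f 0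
sumTo (suc n) f = sumTo n f + f (suc n)

Φ̃ : (ℕ → ℕ) → ℕ → ℕ → ℕ
Φ̃ P k s = sumTo s (λ i → (s C i) * Ψp P k i * Ψp P k (s ∸ i))

-- residues of F_p represented by x ∈ {0,…,p-1}
-- x ∈ G (the subgroup of F_p^* of order t, t ∣ p-1): x ≠ 0 and x^t ≡ 1 (mod p) (x ≥ 1 so x^t ≥ 1)
InG : ℕ → ℕ → ℕ → Set
InG p t x = 1 ≤ x × x < p × p ∣ (x ^ t ∸ 1)

RatHeightLe : ℕ → ℕ → ℕ → Set
RatHeightLe p k x = Σ ℤ λ a → Σ ℕ λ b →
  1 ≤ b × b ≤ k × ℤ.∣ a ∣ ≤ k × (+ p) ℤD.∣ (a ℤ.- (+ b) ℤ.* (+ x))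

intHeight : ℕ → ℕ → ℕ
intHeight p x = x ⊓ (p ∸ x)

InHeightSet : ℕ → ℕ → ℕ → ℕ → Set
InHeightSet p t k h = Σ ℕ λ x → InG p t x × RatHeightLe p k x × intHeight p x ≡ h

-- r = r_1(k) = ⌊log(p/2)/(2 log k)⌋ = max{r : k^(2r) ≤ p/2}
IsR1 : ℕ → ℕ → ℕ → Set
IsR1 p k r = (2 * k ^ (2 * r) ≤ p) × (∀ r′ → 2 * k ^ (2 * r′) ≤ p → r′ ≤ r)

IsS1 : ℕ → ℕ → ℕ → Set
IsS1 r t s = ((r + s) C s ≤ t) × (∀ s′ → (r + s′) C s′ ≤ t → s′ ≤ s)

{-# OPTIONS --safe #-}
-- Write each point x of V(k,t,1) as x ≡ a/b (mod p) with |a|, b ≤ k and attach to it the signature of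
-- |a|/b, its vector of exponents of p₁, …, p_k. Points with distinct heights have distinct ratios |a|/b,
-- hence distinct signatures. Let m be the rank of the signatures and pick m independent ones. The monomials
-- of degree ≤ r in the corresponding points are t-th roots of unity, and they are pairwise incongruent mod p:
-- a congruence would become an equality between products of the |aᵢ| and bᵢ, both sides being below p/2
-- since 2k^(2r) ≤ p, and independence excludes it. Hence binomial(r+m, m) ≤ t, that is m ≤ s.
-- Every signature is determined by its entries at m pivot primes. Moving the positive entries onto
-- p₁, p₂, … and the negative ones likewise encodes |a|/b injectively by a choice of i of the m pivots
-- together with a p_i-smooth and a p_(m-i)-smooth number ≤ k, so there are at most Φ̃(k,m) ≤ Φ̃(k,s) heights.
module Submission where

module Lists where

  open import Data.Bool using (Bool; true; false; if_then_else_)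
  open import Data.Nat
  open import Data.Nat.Properties
  open import Data.List using (List; []; _∷_; length; map; filter; applyUpTo; allFin)
  open import Data.List.Properties using (length-removeAt′; length-map; length-tabulate)
  open import Data.List.Membership.Propositional using (_∈_)
  open import Data.List.Relation.Unary.Any using (here; there; index; _─_)
  open import Data.List.Relation.Unary.All using (All; []; _∷_)
  import Data.List.Relation.Unary.All as All
  open import Data.List.Relation.Unary.AllPairs using (AllPairs; []; _∷_)
  open import Data.Empty using (⊥-elim)
  open import Data.Product using (Σ; _×_; _,_)
  open import Data.Unit using (⊤; tt)
  open import Data.Fin using (Fin; toℕ)
  import Data.Fin.Properties as FinP
  open import Data.List.Membership.Propositional.Properties using (∈-filter⁺; ∈-filter⁻; ∈-map⁺; ∈-allFin; ∈-applyUpTo⁺)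
  import Relation.Unary
  open import Relation.Nullary using (yes; no; does)
  open import Relation.Binary.PropositionalEquality
  open import Defs using (count)

  module _ {A : Set} where

    ∈-─ : ∀ {x y : A} {xs} → y ∈ xs → y ≢ x → (x∈xs : x ∈ xs) → y ∈ (xs ─ x∈xs)
    ∈-─ (here refl) y≢x (here refl) = ⊥-elim (y≢x refl)
    ∈-─ (there y∈) y≢x (here refl) = y∈
    ∈-─ (here refl) y≢x (there x∈) = here refl
    ∈-─ (there y∈) y≢x (there x∈) = there (∈-─ y∈ y≢x x∈)

    distinct-⊆⇒length≤ : ∀ {xs ys : List A} → AllPairs _≢_ xs → All (_∈ ys) xs → length xs ≤ length ys
    distinct-⊆⇒length≤ {[]} _ _ = z≤n
    distinct-⊆⇒length≤ {x ∷ xs} {ys} (x∉xs ∷ xs!) (x∈ys ∷ xs⊆ys) = begin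
      suc (length xs)            ≤⟨ s≤s (distinct-⊆⇒length≤ xs! (All.zipWith shift (x∉xs , xs⊆ys))) ⟩
      suc (length (ys ─ x∈ys))   ≡⟨ length-removeAt′ ys (index x∈ys) ⟨
      length ys                  ∎
      where
      open ≤-Reasoning
      shift : ∀ {y} → x ≢ y × y ∈ ys → y ∈ (ys ─ x∈ys)
      shift (x≢y , y∈ys) = ∈-─ y∈ys (≢-sym x≢y) x∈ys

    AllPairs-mapWithAll : ∀ {P : A → Set} {R S : A → A → Set} → (∀ {u v} → P u → P v → R u v → S u v) →
      ∀ {xs} → All P xs → AllPairs R xs → AllPairs S xs
    AllPairs-mapWithAll f [] [] = []
    AllPairs-mapWithAll f (pu ∷ ps) (r ∷ rs) = All.zipWith (λ (pv , r) → f pu pv r) (ps , r) ∷ AllPairs-mapWithAll f ps rs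

  select : (ℕ → Bool) → ℕ → List ℕ
  select f zero = []
  select f (suc n) = if f (suc n) then suc n ∷ select f n else select f n

  length-select : ∀ f n → length (select f n) ≡ count f n
  length-select f zero = refl
  length-select f (suc n) with f (suc n)
  ... | true = cong suc (length-select f n)
  ... | false = length-select f n

  ∈-select : ∀ f n m → 1 ≤ m → m ≤ n → f m ≡ true → m ∈ select f n
  ∈-select f zero m 1≤m m≤0 fm = ⊥-elim (<-irrefl refl (≤-trans 1≤m m≤0))
  ∈-select f (suc n) m 1≤m m≤n fm with m ≟ suc n
  ... | yes refl rewrite fm = here refl
  ... | no m≢ with f (suc n)
  ...   | true = there (∈-select f n m 1≤m (≤-pred (≤∧≢⇒< m≤n m≢)) fm)
  ...   | false = ∈-select f n m 1≤m (≤-pred (≤∧≢⇒< m≤n m≢)) fm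

  AscendingFrom : ℕ → List ℕ → Set
  AscendingFrom b [] = ⊤
  AscendingFrom b (l ∷ ls) = b < l × AscendingFrom l ls

  AscendingFrom-weaken : ∀ {b b′} ls → b′ ≤ b → AscendingFrom b ls → AscendingFrom b′ ls
  AscendingFrom-weaken [] _ _ = tt
  AscendingFrom-weaken (l ∷ ls) b′≤b (b<l , asc) = ≤-<-trans b′≤b b<l , asc

  AscendingFrom⇒All> : ∀ b ls → AscendingFrom b ls → All (b <_) ls
  AscendingFrom⇒All> b [] _ = []
  AscendingFrom⇒All> b (l ∷ ls) (b<l , asc) = b<l ∷ All.map (<-trans b<l) (AscendingFrom⇒All> l ls asc)

  AscendingFrom⇒distinct : ∀ b ls → AscendingFrom b ls → AllPairs _≢_ ls
  AscendingFrom⇒distinct b [] _ = []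
  AscendingFrom⇒distinct b (l ∷ ls) (_ , asc) = All.map (λ l<l′ l≡l′ → <-irrefl l≡l′ l<l′) (AscendingFrom⇒All> l ls asc) ∷ AscendingFrom⇒distinct l ls asc

  AscendingFrom-filter : ∀ {Q : ℕ → Set} (Q? : Relation.Unary.Decidable Q) b ls → AscendingFrom b ls → AscendingFrom b (filter Q? ls)
  AscendingFrom-filter Q? b [] _ = tt
  AscendingFrom-filter Q? b (l ∷ ls) (b<l , asc) with does (Q? l)
  ... | true = b<l , AscendingFrom-filter Q? l ls asc
  ... | false = AscendingFrom-filter Q? b ls (AscendingFrom-weaken ls (<⇒≤ b<l) asc)

  AscendingFrom-applyUpTo : ∀ (f : ℕ → ℕ) b n → b < f 0 → (∀ i → f i < f (suc i)) → AscendingFrom b (applyUpTo f n)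
  AscendingFrom-applyUpTo f b zero _ _ = tt
  AscendingFrom-applyUpTo f b (suc n) b<f0 f-inc = b<f0 , AscendingFrom-applyUpTo (λ i → f (suc i)) (f 0) n (f-inc 0) (λ i → f-inc (suc i))

  record AscendingCover {m k} (f : Fin m → Fin k) : Set where
    field
      indices : List ℕ
      ascending : AscendingFrom 0 indices
      covers : ∀ j → suc (toℕ (f j)) ∈ indices
      length≤ : length indices ≤ m

  ascendingCover : ∀ {m k} (f : Fin m → Fin k) → AscendingCover f
  ascendingCover {m} {k} f = record { indices = ls ; ascending = ascending ; covers = image⊆ls ; length≤ = length≤m }
    where
    InImage : ℕ → Set
    InImage l = Σ (Fin m) λ j → suc (toℕ (f j)) ≡ l
    InImage? : Relation.Unary.Decidable InImage
    InImage? l = FinP.any? (λ j → suc (toℕ (f j)) ≟ l)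
    ls = filter InImage? (applyUpTo suc k)
    ascending : AscendingFrom 0 ls
    ascending = AscendingFrom-filter InImage? 0 (applyUpTo suc k) (AscendingFrom-applyUpTo suc 0 k (s≤s z≤n) (λ i → ≤-refl))
    image⊆ls : ∀ j → suc (toℕ (f j)) ∈ ls
    image⊆ls j = ∈-filter⁺ InImage? (∈-applyUpTo⁺ suc (FinP.toℕ<n (f j))) (j , refl)
    length≤m : length ls ≤ m
    length≤m = ≤-trans (distinct-⊆⇒length≤ (AscendingFrom⇒distinct 0 ls ascending) (All.tabulate ls⊆image))
                       (≤-reflexive (trans (length-map (λ j → suc (toℕ (f j))) (allFin m)) (length-tabulate {n = m} (λ j → j))))
      where
      ls⊆image : ∀ {l} → l ∈ ls → l ∈ map (λ j → suc (toℕ (f j))) (allFin m)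
      ls⊆image {l} l∈ls with ∈-filter⁻ InImage? {v = l} {xs = applyUpTo suc k} l∈ls
      ... | _ , (j , refl) = ∈-map⁺ (λ j → suc (toℕ (f j))) (∈-allFin j)

module Multiplicity where

  open import Data.Nat
  open import Data.Nat.Properties
  open import Data.Nat.Divisibility
  open import Data.Nat.Primality
  open import Data.Nat.Primality.Factorisation
  open import Data.List using (List; []; _∷_)
  open import Data.Nat.ListAction using (product)
  open import Data.List.Relation.Unary.All using (All; []; _∷_)
  open import Data.Product using (Σ; _×_; _,_)
  open import Data.Sum using (inj₁; inj₂)
  open import Data.Empty using (⊥; ⊥-elim)
  open import Relation.Nullary using (¬_; yes; no; Dec)
  open import Relation.Binary.PropositionalEquality

  -- ν q n is the exponent of q in n, by repeated division with fuel; ν q 0 = 0 and ν q n = 0 for q < 2.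
  mutual
    ν-fuel : ℕ → ℕ → ℕ → ℕ
    ν-fuel q' zero n = 0
    ν-fuel q' (suc f) zero = 0
    ν-fuel q' (suc f) (suc n) = ν-step q' f n (suc (suc q') ∣? suc n)

    ν-step : (q' : ℕ) → ℕ → ℕ → ∀ {N} → Dec (suc (suc q') ∣ N) → ℕ
    ν-step q' f n (yes (divides quo _)) = suc (ν-fuel q' f quo)
    ν-step q' f n (no _) = 0

  ν : ℕ → ℕ → ℕ
  ν zero n = 0
  ν (suc zero) n = 0
  ν (suc (suc q')) n = ν-fuel q' n n

  1≤m*n : ∀ a b → 1 ≤ a → 1 ≤ b → 1 ≤ a * b
  1≤m*n (suc a) (suc b) _ _ = s≤s z≤n

  1≤m^n : ∀ q e → 1 ≤ q → 1 ≤ q ^ e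
  1≤m^n q zero _ = s≤s z≤n
  1≤m^n q (suc e) h = 1≤m*n q (q ^ e) h (1≤m^n q e h)

  ν-fuel-unique : ∀ q' e m f N → N ≡ suc (suc q') ^ e * m → 1 ≤ m → ¬ (suc (suc q') ∣ m) → N ≤ f →
            ν-fuel q' f N ≡ e
  ν-fuel-unique q' e m f zero eqN 1≤m nd le = ⊥-elim (<-irrefl refl (≤-trans (1≤m*n _ m (1≤m^n _ e (s≤s z≤n)) 1≤m) (≤-reflexive (sym eqN))))
  ν-fuel-unique q' e m zero (suc n) eqN 1≤m nd ()
  ν-fuel-unique q' e m (suc f) (suc n) eqN 1≤m nd le = go e eqN (suc (suc q') ∣? suc n)
    where
    Q = suc (suc q')
    go : ∀ e → suc n ≡ Q ^ e * m → (d : Dec (Q ∣ suc n)) → ν-step q' f n d ≡ e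
    go zero eq (yes d) = ⊥-elim (nd (subst (Q ∣_) (trans eq (*-identityˡ m)) d))
    go zero eq (no _) = refl
    go (suc e) eq (no nd') = ⊥-elim (nd' (divides (Q ^ e * m) (trans eq (trans (*-assoc Q (Q ^ e) m) (*-comm Q (Q ^ e * m))))))
    go (suc e) eq (yes (divides quo eq2)) = cong suc (ν-fuel-unique q' e m f quo quo≡ 1≤m nd le')
      where
      quo≡ : quo ≡ Q ^ e * m
      quo≡ = *-cancelʳ-≡ quo (Q ^ e * m) Q (trans (sym eq2) (trans eq (trans (*-assoc Q (Q ^ e) m) (*-comm Q (Q ^ e * m)))))
      x≥1 : 1 ≤ Q ^ e * m
      x≥1 = 1≤m*n _ m (1≤m^n Q e (s≤s z≤n)) 1≤m
      lt : Q ^ e * m < suc n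
      lt = subst (Q ^ e * m <_) (sym (trans eq (*-assoc Q (Q ^ e) m)))
             (subst (Q ^ e * m <_) (*-comm (Q ^ e * m) Q)
               (m<m*n (Q ^ e * m) Q {{>-nonZero x≥1}} (s≤s (s≤s z≤n))))
      le' : quo ≤ f
      le' = ≤-pred (≤-trans (s≤s (≤-reflexive quo≡)) (≤-trans lt le))

  ν-unique : ∀ q e m N → 2 ≤ q → N ≡ q ^ e * m → 1 ≤ m → ¬ (q ∣ m) → ν q N ≡ e
  ν-unique (suc (suc q')) e m N _ eqN 1≤m nd = ν-fuel-unique q' e m N N eqN 1≤m nd ≤-refl
  ν-unique (suc zero) e m N (s≤s ()) eqN 1≤m nd
  ν-unique zero e m N () eqN 1≤m nd

  quotient-pos : ∀ {N q} quo → 1 ≤ N → N ≡ quo * q → 1 ≤ quo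
  quotient-pos zero 1≤N eq = ⊥-elim (<-irrefl refl (≤-trans 1≤N (≤-reflexive eq)))
  quotient-pos (suc _) _ _ = s≤s z≤n

  quotient< : ∀ {N q} quo → 1 ≤ N → 2 ≤ q → N ≡ quo * q → quo < N
  quotient< zero 1≤N _ eq = 1≤N
  quotient< {q = q} (suc z) 1≤N 2≤q eq = subst (suc z <_) (sym eq) (m<m*n (suc z) q 2≤q)

  decompose-fuel : ∀ q f N → 2 ≤ q → 1 ≤ N → N ≤ f → Σ ℕ λ e → Σ ℕ λ m → N ≡ q ^ e * m × 1 ≤ m × ¬ (q ∣ m)
  decompose-fuel q zero N _ 1≤N N≤0 = ⊥-elim (<-irrefl refl (≤-trans 1≤N N≤0))
  decompose-fuel q (suc f) N 2≤q 1≤N le with q ∣? N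
  ... | no nd = 0 , N , sym (*-identityˡ N) , 1≤N , nd
  ... | yes (divides quo eq) with decompose-fuel q f quo 2≤q quo≥1 quo≤f
    where
    quo≥1 : 1 ≤ quo
    quo≥1 = quotient-pos quo 1≤N eq
    quo≤f : quo ≤ f
    quo≤f = ≤-pred (≤-trans (quotient< quo 1≤N 2≤q eq) le)
  ...   | e , m , eqm , 1≤m , nd = suc e , m , trans eq (trans (cong (_* q) eqm) (trans (*-comm (q ^ e * m) q) (sym (*-assoc q (q ^ e) m)))) , 1≤m , nd

  ν-decomposition : ∀ q N → 2 ≤ q → 1 ≤ N → Σ ℕ λ m → N ≡ q ^ ν q N * m × 1 ≤ m × ¬ (q ∣ m)
  ν-decomposition q N 2≤q 1≤N with decompose-fuel q N N 2≤q 1≤N ≤-refl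
  ... | e , m , eq , 1≤m , nd rewrite ν-unique q e m N 2≤q eq 1≤m nd = m , eq , 1≤m , nd

  prime⇒2≤ : ∀ {q} → Prime q → 2 ≤ q
  prime⇒2≤ {q} pr = nonTrivial⇒n>1 q {{prime⇒nonTrivial pr}}

  ν-∤ : ∀ q a → 2 ≤ q → 1 ≤ a → ¬ (q ∣ a) → ν q a ≡ 0
  ν-∤ q a 2≤q 1≤a nd = ν-unique q 0 a a 2≤q (sym (*-identityˡ a)) 1≤a nd

  ν-1 : ∀ q → ν q 1 ≡ 0
  ν-1 zero = refl
  ν-1 (suc zero) = refl
  ν-1 (suc (suc q')) = ν-∤ (suc (suc q')) 1 (s≤s (s≤s z≤n)) (s≤s z≤n) (λ d → contra (∣1⇒≡1 d))
    where contra : suc (suc q') ≡ 1 → ⊥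
          contra ()

  ν-self : ∀ q → 2 ≤ q → ν q q ≡ 1
  ν-self q 2≤q = ν-unique q 1 1 q 2≤q (sym (trans (*-identityʳ (q * 1)) (*-identityʳ q))) (s≤s z≤n)
    (λ d → <-irrefl refl (≤-trans 2≤q (≤-reflexive (∣1⇒≡1 d))))

  ν-* : ∀ q a b → Prime q → 1 ≤ a → 1 ≤ b → ν q (a * b) ≡ ν q a + ν q b
  ν-* q a b pr 1≤a 1≤b with ν-decomposition q a (prime⇒2≤ pr) 1≤a | ν-decomposition q b (prime⇒2≤ pr) 1≤b
  ... | m1 , eq1 , p1 , nd1 | m2 , eq2 , p2 , nd2 =
    ν-unique q (ν q a + ν q b) (m1 * m2) (a * b) (prime⇒2≤ pr) eqab (1≤m*n m1 m2 p1 p2) ndm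
    where
    ea = ν q a
    eb = ν q b
    eqab : a * b ≡ q ^ (ea + eb) * (m1 * m2)
    eqab = begin
      a * b ≡⟨ cong₂ _*_ eq1 eq2 ⟩
      (q ^ ea * m1) * (q ^ eb * m2) ≡⟨ [m*n]*[o*p]≡[m*o]*[n*p] (q ^ ea) m1 (q ^ eb) m2 ⟩
      (q ^ ea * q ^ eb) * (m1 * m2) ≡⟨ cong (_* (m1 * m2)) (sym (^-distribˡ-+-* q ea eb)) ⟩
      q ^ (ea + eb) * (m1 * m2) ∎
      where open ≡-Reasoning
    ndm : ¬ (q ∣ m1 * m2)
    ndm d with euclidsLemma m1 m2 pr d
    ... | inj₁ x = nd1 x
    ... | inj₂ y = nd2 y

  ν-pos⇒∣ : ∀ q a → 1 ≤ a → 1 ≤ ν q a → q ∣ a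
  ν-pos⇒∣ zero a 1≤a ()
  ν-pos⇒∣ (suc zero) a 1≤a ()
  ν-pos⇒∣ (suc (suc q')) a 1≤a h with ν-decomposition (suc (suc q')) a (s≤s (s≤s z≤n)) 1≤a
  ... | m , eq , _ , _ with ν (suc (suc q')) a
  ...   | zero = ⊥-elim (<-irrefl refl h)
  ...   | suc e = divides (suc (suc q') ^ e * m) (trans eq (trans (*-assoc (suc (suc q')) (suc (suc q') ^ e) m) (*-comm (suc (suc q')) (suc (suc q') ^ e * m))))

  n<q⇒ν≡0 : ∀ q a → 1 ≤ a → a < q → ν q a ≡ 0
  n<q⇒ν≡0 zero a _ ()
  n<q⇒ν≡0 (suc zero) a 1≤a (s≤s a≤0) = ⊥-elim (<-irrefl refl (≤-trans 1≤a a≤0))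
  n<q⇒ν≡0 (suc (suc q')) a 1≤a a<q = ν-∤ _ a (s≤s (s≤s z≤n)) 1≤a (λ d → <-irrefl refl (≤-trans a<q (∣⇒≤ {{>-nonZero 1≤a}} d)))

  prime∣prime⇒≡ : ∀ {q r} → Prime q → Prime r → q ∣ r → q ≡ r
  prime∣prime⇒≡ {q} {r} pq pr d with prime⇒irreducible pr d
  ... | inj₁ q≡1 = ⊥-elim (<-irrefl refl (≤-trans (prime⇒2≤ pq) (≤-reflexive q≡1)))
  ... | inj₂ e = e

  ν-distinctPrime : ∀ q r → Prime q → Prime r → q ≢ r → ν q r ≡ 0
  ν-distinctPrime q r pq pr ne = ν-∤ q r (prime⇒2≤ pq) (≤-trans (s≤s z≤n) (prime⇒2≤ pr)) (λ d → ne (prime∣prime⇒≡ pq pr d))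

  ν-^ : ∀ q a e → Prime q → 1 ≤ a → ν q (a ^ e) ≡ e * ν q a
  ν-^ q a zero pq 1≤a = ν-1 q
  ν-^ q a (suc e) pq 1≤a = trans (ν-* q a (a ^ e) pq 1≤a (1≤m^n a e 1≤a)) (cong (ν q a +_) (ν-^ q a e pq 1≤a))

  primeDivisor : ∀ a → 2 ≤ a → Σ ℕ λ r → Prime r × r ∣ a
  primeDivisor a@(suc a') 2≤a with factorise a
  ... | record { factors = [] ; isFactorisation = eq } = ⊥-elim (<-irrefl refl (≤-trans 2≤a (≤-reflexive eq)))
  ... | record { factors = r ∷ rs ; isFactorisation = eq ; factorsPrime = pr ∷ _ } =
    r , pr , divides (product rs) (trans eq (*-comm r (product rs)))

  ν≤⇒∣-fuel : ∀ f a b → a ≤ f → 1 ≤ a → 1 ≤ b → (∀ r → Prime r → ν r a ≤ ν r b) → a ∣ b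
  ν≤⇒∣-fuel f (suc zero) b _ _ _ _ = 1∣ b
  ν≤⇒∣-fuel zero (suc (suc a')) b () _ _ _
  ν≤⇒∣-fuel (suc f) a@(suc (suc a')) b a≤f 1≤a 1≤b h with primeDivisor a (s≤s (s≤s z≤n))
  ... | r , pr , divides a1 eqa = res
    where
    2≤r = prime⇒2≤ pr
    a1≥1 : 1 ≤ a1
    a1≥1 = quotient-pos a1 1≤a eqa
    νra : ν r a ≡ suc (ν r a1)
    νra = trans (cong (ν r) (trans eqa (*-comm a1 r))) (trans (ν-* r r a1 pr (≤-trans (s≤s z≤n) 2≤r) a1≥1) (cong (_+ ν r a1) (ν-self r 2≤r)))
    r∣b : r ∣ b
    r∣b = ν-pos⇒∣ r b 1≤b (≤-trans (s≤s z≤n) (≤-trans (≤-reflexive (sym νra)) (h r pr)))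
    res : a ∣ b
    res with r∣b
    ... | divides b1 eqb = subst₂ _∣_ (sym (trans eqa (*-comm a1 r))) (sym (trans eqb (*-comm b1 r))) (*-monoʳ-∣ r rec)
      where
      b1≥1 : 1 ≤ b1
      b1≥1 = quotient-pos b1 1≤b eqb
      split : ∀ x x1 → 1 ≤ x1 → x ≡ x1 * r → ∀ s → Prime s → ν s x ≡ ν s r + ν s x1
      split x x1 p1 eq s ps = trans (cong (ν s) (trans eq (*-comm x1 r))) (ν-* s r x1 ps (≤-trans (s≤s z≤n) 2≤r) p1)
      rec : a1 ∣ b1
      rec = ν≤⇒∣-fuel f a1 b1 (≤-pred (≤-trans (quotient< a1 1≤a 2≤r eqa) a≤f)) a1≥1 b1≥1
        (λ s ps → +-cancelˡ-≤ (ν s r) (ν s a1) (ν s b1)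
           (subst₂ _≤_ (split a a1 a1≥1 eqa s ps) (split b b1 b1≥1 eqb s ps) (h s ps)))

  ν≤⇒∣ : ∀ a b → 1 ≤ a → 1 ≤ b → (∀ r → Prime r → ν r a ≤ ν r b) → a ∣ b
  ν≤⇒∣ a b = ν≤⇒∣-fuel a a b ≤-refl

  ν-injective : ∀ a b → 1 ≤ a → 1 ≤ b → (∀ r → Prime r → ν r a ≡ ν r b) → a ≡ b
  ν-injective a b 1≤a 1≤b h =
    ∣-antisym (ν≤⇒∣ a b 1≤a 1≤b (λ r pr → ≤-reflexive (h r pr))) (ν≤⇒∣ b a 1≤b 1≤a (λ r pr → ≤-reflexive (sym (h r pr))))

module Primes where

  open import Data.Bool using (Bool; true; false; _∧_; _∨_; not)
  open import Data.Bool.Properties using (∨-zeroʳ; ∨-identityʳ)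
  open import Data.Bool.ListAction using (and)
  open import Data.Nat
  open import Data.Nat.Properties
  open import Data.Nat.Divisibility using (_∣_; _∣?_; ∣1⇒≡1)
  open import Data.Nat.Primality using (Prime; prime?)
  open import Data.List using (List; []; _∷_; map; upTo)
  open import Data.List.Membership.Propositional using (_∈_)
  open import Data.List.Membership.Propositional.Properties using (∈-length)
  open import Data.List.Relation.Unary.Any using (here; there)
  open import Data.Product using (proj₁; proj₂)
  open import Data.Sum using (inj₁; inj₂)
  open import Data.Empty using (⊥-elim)
  open import Relation.Nullary using (yes; no)
  open import Relation.Nullary.Decidable using (⌊_⌋)
  open import Relation.Binary.PropositionalEquality
  open import Relation.Binary.Definitions using (tri<; tri≈; tri>)
  open import Defs
  open Lists
  open Multiplicity

  count-mono : ∀ f n d → count f n ≤ count f (d + n)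
  count-mono f n zero = ≤-refl
  count-mono f n (suc d) with f (suc (d + n))
  ... | true = m≤n⇒m≤1+n (count-mono f n d)
  ... | false = count-mono f n d

  count≤n : ∀ f n → count f n ≤ n
  count≤n f zero = z≤n
  count≤n f (suc n) with f (suc n)
  ... | true = s≤s (count≤n f n)
  ... | false = m≤n⇒m≤1+n (count≤n f n)

  count-⇒-mono : ∀ (f f' : ℕ → Bool) N → (∀ n → f n ≡ true → f' n ≡ true) → count f N ≤ count f' N
  count-⇒-mono f f' zero h = z≤n
  count-⇒-mono f f' (suc N) h with f (suc N) in e1 | f' (suc N) in e2
  ... | true | true = s≤s (count-⇒-mono f f' N h)
  ... | true | false with () ← trans (sym (h (suc N) e1)) e2
  ... | false | true = m≤n⇒m≤1+n (count-⇒-mono f f' N h)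
  ... | false | false = count-⇒-mono f f' N h

  primeCount-mono : ∀ a b → a ≤ b → primeCount a ≤ primeCount b
  primeCount-mono a b a≤b = subst (λ z → primeCount a ≤ primeCount z) (m∸n+n≡m a≤b) (count-mono _ a (b ∸ a))

  primeCount-pos : ∀ q → Prime q → 1 ≤ primeCount q
  primeCount-pos zero pq with () ← prime⇒2≤ pq
  primeCount-pos (suc q) pq with prime? (suc q)
  ... | yes _ = s≤s z≤n
  ... | no ¬pq = ⊥-elim (¬pq pq)

  primeCount-<-prime : ∀ a b → Prime b → a < b → primeCount a < primeCount b
  primeCount-<-prime a (suc b) pb a<b with prime? (suc b)
  ... | yes _ = s≤s (primeCount-mono a b (≤-pred a<b))
  ... | no ¬pb = ⊥-elim (¬pb pb)

  and-map-true : ∀ (f : ℕ → Bool) xs → (∀ q → q ∈ xs → f q ≡ true) → and (map f xs) ≡ true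
  and-map-true f [] h = refl
  and-map-true f (x ∷ xs) h rewrite h x (here refl) = and-map-true f xs (λ q q∈ → h q (there q∈))

  and-map-mono : ∀ (f f' : ℕ → Bool) xs → (∀ q → f q ≡ true → f' q ≡ true) → and (map f xs) ≡ true → and (map f' xs) ≡ true
  and-map-mono f f' [] h e = refl
  and-map-mono f f' (x ∷ xs) h e with f x in fx
  ... | true rewrite h x fx = and-map-mono f f' xs h e
  ... | false with () ← e

  smoothᵇ-complete : ∀ y n → (∀ q → Prime q → q ∣ n → q ≤ y) → smoothᵇ y n ≡ true
  smoothᵇ-complete y n h = and-map-true _ (upTo (suc n)) (λ q _ → smooth-at q)
    where
    smooth-at : ∀ q → (not (⌊ prime? q ⌋ ∧ ⌊ q ∣? n ⌋) ∨ ⌊ q ≤? y ⌋) ≡ true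
    smooth-at q with prime? q
    ... | no _ = refl
    ... | yes pq with q ∣? n
    ...   | no _ = refl
    ...   | yes q∣n with q ≤? y
    ...     | yes _ = refl
    ...     | no q≰y = ⊥-elim (q≰y (h q pq q∣n))

  smoothᵇ-mono : ∀ y y' n → y ≤ y' → smoothᵇ y n ≡ true → smoothᵇ y' n ≡ true
  smoothᵇ-mono y y' n y≤y' = and-map-mono (test y) (test y') (upTo (suc n)) test-mono
    where
    test : ℕ → ℕ → Bool
    test y q = not (⌊ prime? q ⌋ ∧ ⌊ q ∣? n ⌋) ∨ ⌊ q ≤? y ⌋
    test-mono : ∀ q → test y q ≡ true → test y' q ≡ true
    test-mono q e with q ≤? y | q ≤? y'
    ... | yes _ | yes _ = ∨-zeroʳ _
    ... | yes q≤y | no q≰y' = ⊥-elim (q≰y' (≤-trans q≤y y≤y'))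
    ... | no _ | d = cong (_∨ ⌊ d ⌋) (trans (sym (∨-identityʳ _)) e)

  module Enumeration (P : ℕ → ℕ) (isP : IsPrimeEnum P) where

    P-prime : ∀ l → 1 ≤ l → Prime (P l)
    P-prime l h = proj₁ (isP l h)

    primeCount-P : ∀ l → 1 ≤ l → primeCount (P l) ≡ l
    primeCount-P l h = proj₂ (isP l h)

    P-pos : ∀ l → 1 ≤ l → 1 ≤ P l
    P-pos l h = ≤-trans (s≤s z≤n) (prime⇒2≤ (P-prime l h))

    P-strictMono : ∀ a b → 1 ≤ a → a < b → P a < P b
    P-strictMono a b 1≤a a<b with P a <? P b
    ... | yes lt = lt
    ... | no Pa≮Pb = ⊥-elim (<⇒≱ a<b (subst₂ _≤_ (primeCount-P b (≤-trans 1≤a (<⇒≤ a<b))) (primeCount-P a 1≤a)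
                                                  (primeCount-mono (P b) (P a) (≮⇒≥ Pa≮Pb))))

    P-mono : ∀ a b → 1 ≤ a → a ≤ b → P a ≤ P b
    P-mono a b 1≤a a≤b with m≤n⇒m<n∨m≡n a≤b
    ... | inj₁ lt = <⇒≤ (P-strictMono a b 1≤a lt)
    ... | inj₂ refl = ≤-refl

    P-injective : ∀ a b → 1 ≤ a → 1 ≤ b → P a ≡ P b → a ≡ b
    P-injective a b ha hb e = trans (sym (primeCount-P a ha)) (trans (cong primeCount e) (primeCount-P b hb))

    P-primeCount : ∀ q → Prime q → P (primeCount q) ≡ q
    P-primeCount q pq with <-cmp (P (primeCount q)) q
    ... | tri≈ _ e _ = e
    ... | tri< lt _ _ = ⊥-elim (<-irrefl (primeCount-P _ (primeCount-pos q pq)) (primeCount-<-prime _ q pq lt))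
    ... | tri> _ _ gt = ⊥-elim (<-irrefl (sym (primeCount-P _ (primeCount-pos q pq))) (primeCount-<-prime q _ (P-prime _ (primeCount-pos q pq)) gt))

    Ψp-suc-mono : ∀ k → 1 ≤ k → ∀ i → Ψp P k i ≤ Ψp P k (suc i)
    Ψp-suc-mono k 1≤k zero = ≤-trans (∈-length 1∈smooth) (≤-reflexive (length-select _ k))
      where
      1∈smooth : 1 ∈ select (smoothᵇ (P 1)) k
      1∈smooth = ∈-select _ k 1 (s≤s z≤n) 1≤k
        (smoothᵇ-complete (P 1) 1 (λ q pq q∣1 → ⊥-elim (<⇒≱ (prime⇒2≤ pq) (≤-reflexive (∣1⇒≡1 q∣1)))))
    Ψp-suc-mono k 1≤k (suc i) =
      count-⇒-mono _ _ k (λ n → smoothᵇ-mono (P (suc i)) (P (suc (suc i))) n (P-mono (suc i) (suc (suc i)) (s≤s z≤n) (n≤1+n _)))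

module Elimination where

  open import Data.Nat using (ℕ; zero; suc)
  open import Data.Integer using (ℤ; 0ℤ; 1ℤ; _+_; _*_; _-_; -_; _≟_)
  open import Data.Integer.Properties
  open import Data.Integer.Tactic.RingSolver using (solve-∀)
  open import Data.Fin using (Fin; zero; suc)
  open import Data.Fin.Properties using (all?; ¬∀⟶∃¬)
  open import Data.List using (List; []; _∷_)
  open import Data.List.Membership.Propositional using (_∈_)
  open import Data.List.Relation.Unary.Any using (here; there)
  open import Data.Product using (_,_)
  open import Data.Sum using (inj₁; inj₂)
  open import Data.Empty using (⊥-elim)
  open import Relation.Nullary using (yes; no)
  open import Relation.Binary.PropositionalEquality
  open import Algebra.Properties.Semiring.Sum +-*-semiring public
    using (sum; sum-cong-≗; sum-replicate-zero; ∑-distrib-+; ∑-comm; *-distribˡ-sum)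

  ∑-linear : ∀ {m} (x y : ℤ) (f g : Fin m → ℤ) → sum (λ i → x * f i + y * g i) ≡ x * sum f + y * sum g
  ∑-linear x y f g = trans (∑-distrib-+ (λ i → x * f i) (λ i → y * g i))
    (sym (cong₂ _+_ (*-distribˡ-sum x f) (*-distribˡ-sum y g)))

  ∑-δ : ∀ {m} (f : Fin m → ℤ) (l : Fin m) → (∀ j → j ≢ l → f j ≡ 0ℤ) → sum f ≡ f l
  ∑-δ {suc m} f zero h = trans (cong (f zero +_) (trans (sum-cong-≗ (λ i → h (suc i) (λ ()))) (sum-replicate-zero m))) (+-identityʳ (f zero))
  ∑-δ {suc m} f (suc l) h = trans (cong (_+ sum (λ i → f (suc i))) (h zero (λ ())))
    (trans (+-identityˡ _) (∑-δ (λ i → f (suc i)) l (λ j j≢l → h (suc j) (λ { refl → j≢l refl }))))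

  *-cancelʳ-≡0 : ∀ x y → x * y ≡ 0ℤ → y ≢ 0ℤ → x ≡ 0ℤ
  *-cancelʳ-≡0 x y e y≢0 with i*j≡0⇒i≡0∨j≡0 x e
  ... | inj₁ x≡0 = x≡0
  ... | inj₂ y≡0 = ⊥-elim (y≢0 y≡0)

  module _ {E : Set} (M : ℕ) (vec : E → Fin M → ℤ) where

    -- A fraction-free reduced echelon basis of the span of R: row j is scale times the j-th reduced basis vector.
    record PivotBasis (R : List E) : Set where
      field
        rank : ℕ
        basis : Fin rank → E
        basis-∈ : ∀ i → basis i ∈ R
        pivot : Fin rank → Fin M
        scale : ℤ
        scale≢0 : scale ≢ 0ℤ
        row : Fin rank → Fin M → ℤ
        row-pivot : ∀ j → row j (pivot j) ≡ scale
        row-offPivot : ∀ j l → j ≢ l → row j (pivot l) ≡ 0ℤ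
        reconstruct : ∀ v → v ∈ R → ∀ c → scale * vec v c ≡ sum (λ j → vec v (pivot j) * row j c)
        independent : ∀ (w : Fin rank → ℤ) → (∀ c → sum (λ i → w i * vec (basis i) c) ≡ 0ℤ) → ∀ i → w i ≡ 0ℤ

    empty : PivotBasis []
    empty = record
      { rank = 0 ; basis = λ () ; basis-∈ = λ () ; pivot = λ () ; scale = 1ℤ ; scale≢0 = λ () ; row = λ ()
      ; row-pivot = λ () ; row-offPivot = λ () ; reconstruct = λ _ () ; independent = λ _ _ () }

    module Extend {R : List E} (st : PivotBasis R) (e : E) where
      open PivotBasis st

      combine : (Fin M → ℤ) → Fin M → ℤ
      combine v c = sum (λ j → v (pivot j) * row j c)

      residual : Fin M → ℤ
      residual c = scale * vec e c - combine (vec e) c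

      combine-pivot : ∀ v l → combine v (pivot l) ≡ v (pivot l) * scale
      combine-pivot v l = trans
        (∑-δ (λ j → v (pivot j) * row j (pivot l)) l (λ j j≢l → trans (cong (v (pivot j) *_) (row-offPivot j l j≢l)) (*-zeroʳ (v (pivot j)))))
        (cong (v (pivot l) *_) (row-pivot l))

      residual-pivot : ∀ l → residual (pivot l) ≡ 0ℤ
      residual-pivot l = trans (cong (λ z → scale * vec e (pivot l) - z) (combine-pivot (vec e) l)) (cancel scale (vec e (pivot l)))
        where cancel : ∀ a b → a * b - b * a ≡ 0ℤ
              cancel = solve-∀

      dependent : (∀ c → residual c ≡ 0ℤ) → PivotBasis (e ∷ R)
      dependent zero-residual = record
        { rank = rank ; basis = basis ; basis-∈ = λ i → there (basis-∈ i) ; pivot = pivot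
        ; scale = scale ; scale≢0 = scale≢0 ; row = row ; row-pivot = row-pivot ; row-offPivot = row-offPivot
        ; reconstruct = λ { _ (here refl) c → i-j≡0⇒i≡j _ _ (zero-residual c) ; v (there v∈R) c → reconstruct v v∈R c }
        ; independent = independent }

      -- e becomes a new basis vector with pivot c₀; the old rows are cleared in column c₀.
      module NewPivot (c₀ : Fin M) (d≢0 : residual c₀ ≢ 0ℤ) where
        d = residual c₀

        basis′ : Fin (suc rank) → E
        basis′ zero = e
        basis′ (suc i) = basis i

        pivot′ : Fin (suc rank) → Fin M
        pivot′ zero = c₀
        pivot′ (suc j) = pivot j

        row′ : Fin (suc rank) → Fin M → ℤ
        row′ zero c = scale * residual c
        row′ (suc j) c = d * row j c - row j c₀ * residual c

        row′-pivot : ∀ j → row′ j (pivot′ j) ≡ scale * d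
        row′-pivot zero = refl
        row′-pivot (suc j) = trans (cong₂ (λ a b → d * a - row j c₀ * b) (row-pivot j) (residual-pivot j)) (lem d scale (row j c₀))
          where lem : ∀ d D x → d * D - x * 0ℤ ≡ D * d
                lem = solve-∀

        row′-offPivot : ∀ j l → j ≢ l → row′ j (pivot′ l) ≡ 0ℤ
        row′-offPivot zero zero j≢l = ⊥-elim (j≢l refl)
        row′-offPivot zero (suc l) _ = trans (cong (scale *_) (residual-pivot l)) (*-zeroʳ scale)
        row′-offPivot (suc j) zero _ = lem d (row j c₀)
          where lem : ∀ d x → d * x - x * d ≡ 0ℤ
                lem = solve-∀
        row′-offPivot (suc j) (suc l) j≢l =
          trans (cong₂ (λ a b → d * a - row j c₀ * b) (row-offPivot j l (λ e → j≢l (cong suc e))) (residual-pivot l)) (lem d (row j c₀))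
          where lem : ∀ d x → d * 0ℤ - x * 0ℤ ≡ 0ℤ
                lem = solve-∀

        combine′ : ∀ (v : Fin M → ℤ) c → sum (λ j → v (pivot′ j) * row′ j c)
                   ≡ v c₀ * (scale * residual c) + (d * combine v c + (- residual c) * combine v c₀)
        combine′ v c = cong (λ z → v c₀ * (scale * residual c) + z)
          (trans (sum-cong-≗ (λ j → lem (v (pivot j)) d (row j c) (row j c₀) (residual c)))
                 (∑-linear d (- residual c) (λ j → v (pivot j) * row j c) (λ j → v (pivot j) * row j c₀)))
          where lem : ∀ a d b b₀ w → a * (d * b - b₀ * w) ≡ d * (a * b) + (- w) * (a * b₀)
                lem = solve-∀

        reconstruct′ : ∀ v → v ∈ (e ∷ R) → ∀ c → (scale * d) * vec v c ≡ sum (λ j → vec v (pivot′ j) * row′ j c)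
        reconstruct′ v (here refl) c = sym (trans (combine′ (vec e) c)
            (trans (cong₂ (λ a b → vec e c₀ * (scale * residual c) + (d * a + (- residual c) * b)) (combine-residual c) (combine-residual c₀))
              (lem (vec e c₀) scale (residual c) d (vec e c))))
          where
          combine-residual : ∀ c → combine (vec e) c ≡ scale * vec e c - residual c
          combine-residual c = lem (scale * vec e c) (combine (vec e) c)
            where lem : ∀ a b → b ≡ a - (a - b)
                  lem = solve-∀
          lem : ∀ u₀ D w d u → u₀ * (D * w) + (d * (D * u - w) + (- w) * (D * u₀ - d)) ≡ D * d * u
          lem = solve-∀
        reconstruct′ v (there v∈R) c = sym (trans (combine′ (vec v) c)
            (trans (cong₂ (λ a b → vec v c₀ * (scale * residual c) + (d * a + (- residual c) * b)) (sym (reconstruct v v∈R c)) (sym (reconstruct v v∈R c₀)))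
              (lem (vec v c₀) scale (residual c) d (vec v c))))
          where lem : ∀ v₀ D w d v → v₀ * (D * w) + (d * (D * v) + (- w) * (D * v₀)) ≡ D * d * v
                lem = solve-∀

        module Relation (w : Fin (suc rank) → ℤ) (hw : ∀ c → sum (λ i → w i * vec (basis′ i) c) ≡ 0ℤ) where
          w₀ = w zero

          T : Fin M → ℤ
          T c = sum (λ i → w (suc i) * vec (basis i) c)

          γ : Fin rank → ℤ
          γ j = w₀ * vec e (pivot j) + T (pivot j)

          scale-T : ∀ c → scale * T c ≡ sum (λ j → T (pivot j) * row j c)
          scale-T c = begin
            scale * T c
              ≡⟨ *-distribˡ-sum scale (λ i → w (suc i) * vec (basis i) c) ⟩
            sum (λ i → scale * (w (suc i) * vec (basis i) c))
              ≡⟨ sum-cong-≗ (λ i → lem₁ scale (w (suc i)) _) ⟩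
            sum (λ i → w (suc i) * (scale * vec (basis i) c))
              ≡⟨ sum-cong-≗ (λ i → cong (w (suc i) *_) (reconstruct (basis i) (basis-∈ i) c)) ⟩
            sum (λ i → w (suc i) * sum (λ j → vec (basis i) (pivot j) * row j c))
              ≡⟨ sum-cong-≗ (λ i → *-distribˡ-sum (w (suc i)) (λ j → vec (basis i) (pivot j) * row j c)) ⟩
            sum (λ i → sum (λ j → w (suc i) * (vec (basis i) (pivot j) * row j c)))
              ≡⟨ ∑-comm (λ i j → w (suc i) * (vec (basis i) (pivot j) * row j c)) ⟩
            sum (λ j → sum (λ i → w (suc i) * (vec (basis i) (pivot j) * row j c)))
              ≡⟨ sum-cong-≗ (λ j → sum-cong-≗ (λ i → lem₂ (w (suc i)) _ (row j c))) ⟩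
            sum (λ j → sum (λ i → row j c * (w (suc i) * vec (basis i) (pivot j))))
              ≡⟨ sum-cong-≗ (λ j → *-distribˡ-sum (row j c) (λ i → w (suc i) * vec (basis i) (pivot j))) ⟨
            sum (λ j → row j c * T (pivot j))
              ≡⟨ sum-cong-≗ (λ j → *-comm (row j c) (T (pivot j))) ⟩
            sum (λ j → T (pivot j) * row j c) ∎
            where
            open ≡-Reasoning
            lem₁ : ∀ D w x → D * (w * x) ≡ w * (D * x)
            lem₁ = solve-∀
            lem₂ : ∀ w a b → w * (a * b) ≡ b * (w * a)
            lem₂ = solve-∀

          key : ∀ c → w₀ * residual c + sum (λ j → γ j * row j c) ≡ 0ℤ
          key c = begin
            w₀ * residual c + sum (λ j → γ j * row j c)
              ≡⟨ cong (w₀ * residual c +_) (sum-cong-≗ (λ j → lem₁ w₀ (vec e (pivot j)) (T (pivot j)) (row j c))) ⟩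
            w₀ * residual c + sum (λ j → w₀ * (vec e (pivot j) * row j c) + 1ℤ * (T (pivot j) * row j c))
              ≡⟨ cong (w₀ * residual c +_) (∑-linear w₀ 1ℤ (λ j → vec e (pivot j) * row j c) (λ j → T (pivot j) * row j c)) ⟩
            w₀ * residual c + (w₀ * combine (vec e) c + 1ℤ * sum (λ j → T (pivot j) * row j c))
              ≡⟨ cong (λ z → w₀ * residual c + (w₀ * combine (vec e) c + 1ℤ * z)) (scale-T c) ⟨
            w₀ * residual c + (w₀ * combine (vec e) c + 1ℤ * (scale * T c))
              ≡⟨ lem₂ w₀ scale (vec e c) (combine (vec e) c) (T c) ⟩
            scale * (w₀ * vec e c + T c)
              ≡⟨ cong (scale *_) (hw c) ⟩
            scale * 0ℤ
              ≡⟨ *-zeroʳ scale ⟩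
            0ℤ ∎
            where
            open ≡-Reasoning
            lem₁ : ∀ w₀ a s b → (w₀ * a + s) * b ≡ w₀ * (a * b) + 1ℤ * (s * b)
            lem₁ = solve-∀
            lem₂ : ∀ w₀ D u S T → w₀ * (D * u - S) + (w₀ * S + 1ℤ * (D * T)) ≡ D * (w₀ * u + T)
            lem₂ = solve-∀

          γ≡0 : ∀ l → γ l ≡ 0ℤ
          γ≡0 l = *-cancelʳ-≡0 (γ l) scale (trans (sym eq) (key (pivot l))) scale≢0
            where
            eq : w₀ * residual (pivot l) + sum (λ j → γ j * row j (pivot l)) ≡ γ l * scale
            eq = trans (cong₂ _+_ (trans (cong (w₀ *_) (residual-pivot l)) (*-zeroʳ w₀))
                                  (∑-δ (λ j → γ j * row j (pivot l)) l (λ j j≢l → trans (cong (γ j *_) (row-offPivot j l j≢l)) (*-zeroʳ (γ j)))))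
                       (trans (+-identityˡ _) (cong (γ l *_) (row-pivot l)))

          w₀≡0 : w₀ ≡ 0ℤ
          w₀≡0 = *-cancelʳ-≡0 w₀ d (trans (sym eq) (key c₀)) d≢0
            where
            eq : w₀ * d + sum (λ j → γ j * row j c₀) ≡ w₀ * d
            eq = trans (cong (w₀ * d +_) (trans (sum-cong-≗ (λ j → trans (cong (_* row j c₀) (γ≡0 j)) (*-zeroˡ (row j c₀)))) (sum-replicate-zero rank)))
                       (+-identityʳ (w₀ * d))

          w≡0 : ∀ i → w i ≡ 0ℤ
          w≡0 zero = w₀≡0
          w≡0 (suc i) = independent (λ i → w (suc i)) tail≡0 i
            where
            tail≡0 : ∀ c → T c ≡ 0ℤ
            tail≡0 c = trans (sym (trans (cong (_+ T c) (trans (cong (_* vec e c) w₀≡0) (*-zeroˡ (vec e c)))) (+-identityˡ (T c)))) (hw c)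

        extended : PivotBasis (e ∷ R)
        extended = record
          { rank = suc rank ; basis = basis′ ; basis-∈ = λ { zero → here refl ; (suc i) → there (basis-∈ i) }
          ; pivot = pivot′ ; scale = scale * d
          ; scale≢0 = λ eq → d≢0 (*-cancelʳ-≡0 d scale (trans (*-comm d scale) eq) scale≢0)
          ; row = row′ ; row-pivot = row′-pivot ; row-offPivot = row′-offPivot
          ; reconstruct = reconstruct′ ; independent = Relation.w≡0 }

      extend : PivotBasis (e ∷ R)
      extend with all? (λ c → residual c ≟ 0ℤ)
      ... | yes zero-residual = dependent zero-residual
      ... | no nonzero with ¬∀⟶∃¬ M (λ c → residual c ≡ 0ℤ) (λ c → residual c ≟ 0ℤ) nonzero
      ...   | c₀ , d≢0 = NewPivot.extended c₀ d≢0

    pivotBasis : ∀ R → PivotBasis R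
    pivotBasis [] = empty
    pivotBasis (e ∷ R) = Extend.extend (pivotBasis R) e

module Congruence where

  open import Data.Nat as ℕ using (ℕ; zero; suc; _<_; _≤_)
  import Data.Nat.Properties as ℕP
  import Data.Nat.Divisibility as ℕD
  open import Data.Nat.Primality using (Prime; euclidsLemma; prime⇒nonTrivial)
  open import Data.Integer using (ℤ; +_; 0ℤ; 1ℤ; _+_; _*_; _-_; -_; ∣_∣; _^_)
  open import Data.Integer.Properties
  open import Data.Integer.Divisibility.Signed renaming (_∣_ to _∣ₛ_)
  open import Data.Integer.Tactic.RingSolver using (solve-∀)
  open import Data.Sum using (_⊎_; inj₁; inj₂)
  open import Data.Empty using (⊥-elim)
  open import Relation.Nullary using (¬_)
  open import Relation.Binary.PropositionalEquality

  infix 4 _≈_[mod_]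
  record _≈_[mod_] (a b : ℤ) (p : ℕ) : Set where
    constructor ≈-mod
    field ∣-difference : + p ∣ₛ (a - b)
  open _≈_[mod_] public

  module _ {p : ℕ} where

    ≈-refl : ∀ {a} → a ≈ a [mod p ]
    ≈-refl {a} = ≈-mod (subst (+ p ∣ₛ_) (sym (+-inverseʳ a)) (divides 0ℤ refl))

    ≈-reflexive : ∀ {a b} → a ≡ b → a ≈ b [mod p ]
    ≈-reflexive {a} refl = ≈-refl {a}

    ≈-sym : ∀ {a b} → a ≈ b [mod p ] → b ≈ a [mod p ]
    ≈-sym {a} {b} (≈-mod h) = ≈-mod (subst (+ p ∣ₛ_) (lem a b) (∣m⇒∣-m h))
      where lem : ∀ a b → - (a - b) ≡ b - a
            lem = solve-∀

    ≈-trans : ∀ {a b c} → a ≈ b [mod p ] → b ≈ c [mod p ] → a ≈ c [mod p ]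
    ≈-trans {a} {b} {c} (≈-mod h₁) (≈-mod h₂) = ≈-mod (subst (+ p ∣ₛ_) (lem a b c) (∣m∣n⇒∣m+n h₁ h₂))
      where lem : ∀ a b c → (a - b) + (b - c) ≡ a - c
            lem = solve-∀

    ≈-* : ∀ {a b c d} → a ≈ b [mod p ] → c ≈ d [mod p ] → a * c ≈ b * d [mod p ]
    ≈-* {a} {b} {c} {d} (≈-mod h₁) (≈-mod h₂) = ≈-mod (subst (+ p ∣ₛ_) (lem a b c d) (∣m∣n⇒∣m+n (∣m⇒∣m*n c h₁) (∣n⇒∣m*n b h₂)))
      where lem : ∀ a b c d → (a - b) * c + b * (c - d) ≡ a * c - b * d
            lem = solve-∀

    ≈0⇒∣ : ∀ {a} → a ≈ 0ℤ [mod p ] → + p ∣ₛ a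
    ≈0⇒∣ (≈-mod h) = subst (+ p ∣ₛ_) (+-identityʳ _) h

    ∣⇒≈0 : ∀ {a} → + p ∣ₛ a → a ≈ 0ℤ [mod p ]
    ∣⇒≈0 h = ≈-mod (subst (+ p ∣ₛ_) (sym (+-identityʳ _)) h)

    ≈-^ : ∀ {a b} n → a ≈ b [mod p ] → a ^ n ≈ b ^ n [mod p ]
    ≈-^ zero h = ≈-refl
    ≈-^ (suc n) h = ≈-* h (≈-^ n h)

  ∣n∣<p⇒n≡0 : ∀ {p n} → p ℕD.∣ n → n < p → n ≡ 0
  ∣n∣<p⇒n≡0 {p} {zero} _ _ = refl
  ∣n∣<p⇒n≡0 {p} {suc n} d lt = ⊥-elim (ℕP.<-irrefl refl (ℕP.≤-trans lt (ℕD.∣⇒≤ d)))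

  p∤n : ∀ {p n} → 1 ≤ n → n < p → ¬ (p ℕD.∣ n)
  p∤n 1≤n n<p d with ∣n∣<p⇒n≡0 d n<p
  ... | refl = ℕP.<-irrefl refl 1≤n

  ≈-residue⇒≡ : ∀ {p} a b → a < p → b < p → + a ≈ + b [mod p ] → a ≡ b
  ≈-residue⇒≡ {p} a b a<p b<p (≈-mod p∣a-b) = +-injective (i-j≡0⇒i≡j (+ a) (+ b) (∣i∣≡0⇒i≡0 (∣n∣<p⇒n≡0 (∣⇒∣ᵤ p∣a-b) ∣a-b∣<p)))
    where
    ∣a-b∣<p : ∣ + a - + b ∣ < p
    ∣a-b∣<p = ℕP.≤-<-trans (ℕP.≤-reflexive (cong ∣_∣ ([+m]-[+n]≡m⊖n a b))) (ℕP.≤-<-trans (∣m⊝n∣≤m⊔n a b) (ℕP.⊔-lub a<p b<p))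

  module _ {p : ℕ} (pr : Prime p) where

    prime-∣* : ∀ a b → + p ∣ₛ a * b → + p ∣ₛ a ⊎ + p ∣ₛ b
    prime-∣* a b d with euclidsLemma ∣ a ∣ ∣ b ∣ pr (subst (p ℕD.∣_) (abs-* a b) (∣⇒∣ᵤ d))
    ... | inj₁ x = inj₁ (∣ᵤ⇒∣ x)
    ... | inj₂ y = inj₂ (∣ᵤ⇒∣ y)

    prime∤1 : ¬ (+ p ∣ₛ 1ℤ)
    prime∤1 d = ℕP.<-irrefl refl (ℕP.≤-trans (ℕ.nonTrivial⇒n>1 p {{prime⇒nonTrivial pr}}) (ℕP.≤-reflexive (ℕD.∣1⇒≡1 (∣⇒∣ᵤ d))))

module Roots where

  open import Data.Nat as ℕ using (ℕ; zero; suc; _≤_; z≤n; s≤s)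
  import Data.Nat.Properties as ℕP
  open import Data.Nat.Primality using (Prime)
  open import Data.Integer using (ℤ; +_; 0ℤ; 1ℤ; _+_; _*_; _-_; -_; _^_)
  open import Data.Integer.Properties
  open import Data.Integer.Divisibility.Signed using (∣m+n∣n⇒∣m; ∣m⇒∣-m) renaming (_∣_ to _∣ₛ_)
  open import Data.Integer.Tactic.RingSolver using (solve-∀)
  open import Data.List using (List; []; _∷_; length; replicate)
  open import Data.List.Properties using (length-replicate)
  open import Data.List.Relation.Unary.All using (All; []; _∷_)
  open import Data.List.Relation.Unary.AllPairs using (AllPairs; []; _∷_)
  open import Data.Sum using (inj₁; inj₂)
  open import Data.Empty using (⊥-elim)
  open import Relation.Nullary using (¬_)
  open import Relation.Binary.PropositionalEquality
  open Congruence

  -- cs = [c₀, …, cₙ₋₁] stands for the monic polynomial c₀ + c₁x + ⋯ + cₙ₋₁xⁿ⁻¹ + xⁿ.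
  evalMonic : List ℤ → ℤ → ℤ
  evalMonic [] x = 1ℤ
  evalMonic (c ∷ cs) x = c + x * evalMonic cs x

  -- The quotient of (c ∷ cs) by (x - z): Horner evaluations of the tails at z.
  quotientBy : ℤ → List ℤ → ℤ → List ℤ
  quotientBy c [] z = []
  quotientBy c (c′ ∷ cs) z = evalMonic (c′ ∷ cs) z ∷ quotientBy c′ cs z

  length-quotientBy : ∀ c cs z → length (quotientBy c cs z) ≡ length cs
  length-quotientBy c [] z = refl
  length-quotientBy c (c′ ∷ cs) z = cong suc (length-quotientBy c′ cs z)

  division : ∀ c cs x z → evalMonic (c ∷ cs) x ≡ (x - z) * evalMonic (quotientBy c cs z) x + evalMonic (c ∷ cs) z
  division c [] x z = lem c x z
    where lem : ∀ c x z → c + x * 1ℤ ≡ (x - z) * 1ℤ + (c + z * 1ℤ)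
          lem = solve-∀
  division c (c′ ∷ cs) x z = trans (cong (λ w → c + x * w) (division c′ cs x z)) (lem c x z (evalMonic (quotientBy c′ cs z) x) (evalMonic (c′ ∷ cs) z))
    where lem : ∀ c x z H gz → c + x * ((x - z) * H + gz) ≡ (x - z) * (gz + x * H) + (c + z * gz)
          lem = solve-∀

  module _ {p : ℕ} (pr : Prime p) where

    roots≤degree : ∀ cs zs → AllPairs (λ a b → ¬ (a ≈ b [mod p ])) zs → All (λ z → evalMonic cs z ≈ 0ℤ [mod p ]) zs →
                   length zs ≤ length cs
    roots≤degree cs [] _ _ = z≤n
    roots≤degree [] (z ∷ zs) _ (z-root ∷ _) = ⊥-elim (prime∤1 pr (≈0⇒∣ z-root))
    roots≤degree (c ∷ cs) (z ∷ zs) (z≉zs ∷ zs!) (z-root ∷ zs-roots) =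
      ℕP.≤-trans (s≤s (roots≤degree (quotientBy c cs z) zs zs! (roots-of-quotient zs z≉zs zs-roots)))
                 (ℕP.≤-reflexive (cong suc (length-quotientBy c cs z)))
      where
      roots-of-quotient : ∀ ws → All (λ w → ¬ (z ≈ w [mod p ])) ws → All (λ w → evalMonic (c ∷ cs) w ≈ 0ℤ [mod p ]) ws →
                          All (λ w → evalMonic (quotientBy c cs z) w ≈ 0ℤ [mod p ]) ws
      roots-of-quotient [] [] [] = []
      roots-of-quotient (w ∷ ws) (z≉w ∷ z≉ws) (w-root ∷ ws-roots) = w-root′ ∷ roots-of-quotient ws z≉ws ws-roots
        where
        factored : + p ∣ₛ (w - z) * evalMonic (quotientBy c cs z) w
        factored = ∣m+n∣n⇒∣m (subst (+ p ∣ₛ_) (division c cs w z) (≈0⇒∣ w-root)) (≈0⇒∣ z-root)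
        w-root′ : evalMonic (quotientBy c cs z) w ≈ 0ℤ [mod p ]
        w-root′ with prime-∣* pr _ _ factored
        ... | inj₂ h = ∣⇒≈0 h
        ... | inj₁ h = ⊥-elim (z≉w (≈-mod (subst (+ p ∣ₛ_) (lem w z) (∣m⇒∣-m h))))
          where lem : ∀ w z → - (w - z) ≡ z - w
                lem = solve-∀

  xⁿ-1 : ℕ → List ℤ
  xⁿ-1 zero = []
  xⁿ-1 (suc n) = - 1ℤ ∷ replicate n 0ℤ

  length-xⁿ-1 : ∀ n → length (xⁿ-1 n) ≡ n
  length-xⁿ-1 zero = refl
  length-xⁿ-1 (suc n) = cong suc (length-replicate n)

  evalMonic-xⁿ-1 : ∀ n .{{_ : ℕ.NonZero n}} x → evalMonic (xⁿ-1 n) x ≡ x ^ n - 1ℤ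
  evalMonic-xⁿ-1 (suc n) x = trans (cong (λ w → - 1ℤ + x * w) (evalMonic-xⁿ n)) (+-comm (- 1ℤ) (x * x ^ n))
    where
    evalMonic-xⁿ : ∀ n → evalMonic (replicate n 0ℤ) x ≡ x ^ n
    evalMonic-xⁿ zero = refl
    evalMonic-xⁿ (suc n) = trans (+-identityˡ _) (cong (x *_) (evalMonic-xⁿ n))

module Monomials where

  open import Data.Nat as ℕ using (ℕ; zero; suc; _≤_; z≤n; s≤s)
  import Data.Nat.Properties as ℕP
  open import Data.Nat.Combinatorics using (_C_; nCn≡1; nCk+nC[k+1]≡[n+1]C[k+1])
  open import Data.Integer as ℤ using (ℤ; +_; 1ℤ; ∣_∣)
  open import Data.Integer.Properties using (pos-*; abs-*; ^-*-assoc; ^-zeroˡ)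
  open import Data.Integer.Tactic.RingSolver using (solve-∀)
  open import Data.Fin using (Fin; zero; suc)
  open import Data.Vec using (Vec; []; _∷_; tail)
  open import Data.List using (List; []; _∷_; length; map; _++_; [_])
  open import Data.List.Properties using (length-++; length-map)
  open import Data.List.Membership.Propositional using (_∈_)
  open import Data.List.Membership.Propositional.Properties using (∈-map⁻)
  open import Data.List.Relation.Unary.All using (All; []; _∷_)
  import Data.List.Relation.Unary.All as All
  import Data.List.Relation.Unary.All.Properties as AllP
  open import Data.List.Relation.Unary.AllPairs using (AllPairs; []; _∷_)
  import Data.List.Relation.Unary.AllPairs as AllPairs
  import Data.List.Relation.Unary.AllPairs.Properties as AllPairsP
  open import Data.Product using (_,_)
  open import Relation.Binary.PropositionalEquality hiding ([_])
  open Congruence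

  degree : ∀ {m} → Vec ℕ m → ℕ
  degree [] = 0
  degree (x ∷ xs) = x ℕ.+ degree xs

  incrementHead : ∀ {m} → Vec ℕ (suc m) → Vec ℕ (suc m)
  incrementHead (x ∷ xs) = suc x ∷ xs

  exponentVectors : (m r : ℕ) → List (Vec ℕ m)
  exponentVectors zero r = [ [] ]
  exponentVectors (suc m) zero = map (0 ∷_) (exponentVectors m zero)
  exponentVectors (suc m) (suc r) = map (0 ∷_) (exponentVectors m (suc r)) ++ map incrementHead (exponentVectors (suc m) r)

  length-exponentVectors : ∀ m r → length (exponentVectors m r) ≡ (r ℕ.+ m) C m
  length-exponentVectors zero r = refl
  length-exponentVectors (suc m) zero =
    trans (length-map (0 ∷_) (exponentVectors m zero)) (trans (length-exponentVectors m zero) (trans (nCn≡1 m) (sym (nCn≡1 (suc m)))))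
  length-exponentVectors (suc m) (suc r) = begin
    length (map (0 ∷_) (exponentVectors m (suc r)) ++ map incrementHead (exponentVectors (suc m) r))
      ≡⟨ length-++ (map (0 ∷_) (exponentVectors m (suc r))) ⟩
    length (map (0 ∷_) (exponentVectors m (suc r))) ℕ.+ length (map incrementHead (exponentVectors (suc m) r))
      ≡⟨ cong₂ ℕ._+_ (length-map (0 ∷_) (exponentVectors m (suc r))) (length-map incrementHead (exponentVectors (suc m) r)) ⟩
    length (exponentVectors m (suc r)) ℕ.+ length (exponentVectors (suc m) r)
      ≡⟨ cong₂ ℕ._+_ (length-exponentVectors m (suc r)) (length-exponentVectors (suc m) r) ⟩
    (suc r ℕ.+ m) C m ℕ.+ (r ℕ.+ suc m) C suc m
      ≡⟨ cong (λ z → (suc r ℕ.+ m) C m ℕ.+ z C suc m) (ℕP.+-suc r m) ⟩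
    suc (r ℕ.+ m) C m ℕ.+ suc (r ℕ.+ m) C suc m
      ≡⟨ nCk+nC[k+1]≡[n+1]C[k+1] (suc (r ℕ.+ m)) m ⟩
    suc (suc (r ℕ.+ m)) C suc m
      ≡⟨ cong (λ z → suc z C suc m) (ℕP.+-suc r m) ⟨
    (suc r ℕ.+ suc m) C suc m ∎
    where open ≡-Reasoning

  exponentVectors-degree : ∀ m r → All (λ e → degree e ≤ r) (exponentVectors m r)
  exponentVectors-degree zero r = z≤n ∷ []
  exponentVectors-degree (suc m) zero = AllP.map⁺ (exponentVectors-degree m zero)
  exponentVectors-degree (suc m) (suc r) =
    AllP.++⁺ (AllP.map⁺ (exponentVectors-degree m (suc r))) (AllP.map⁺ (incremented (exponentVectors-degree (suc m) r)))
    where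
    incremented : ∀ {es} → All (λ e → degree e ≤ r) es → All (λ e → degree (incrementHead e) ≤ suc r) es
    incremented [] = []
    incremented {(_ ∷ _) ∷ _} (h ∷ hs) = s≤s h ∷ incremented hs

  exponentVectors-distinct : ∀ m r → AllPairs _≢_ (exponentVectors m r)
  exponentVectors-distinct zero r = [] ∷ []
  exponentVectors-distinct (suc m) zero =
    AllPairsP.map⁺ (AllPairs.map (λ ne eq → ne (cong tail eq)) (exponentVectors-distinct m zero))
  exponentVectors-distinct (suc m) (suc r) = AllPairsP.++⁺
    (AllPairsP.map⁺ (AllPairs.map (λ ne eq → ne (cong tail eq)) (exponentVectors-distinct m (suc r))))
    (AllPairsP.map⁺ (AllPairs.map (λ {a} {b} ne eq → ne (incrementHead-injective a b eq)) (exponentVectors-distinct (suc m) r)))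
    (All.tabulate (λ x∈ → All.tabulate (λ y∈ → zero≢incremented x∈ y∈)))
    where
    incrementHead-injective : ∀ a b → incrementHead a ≡ incrementHead b → a ≡ b
    incrementHead-injective (x ∷ a) (y ∷ b) refl = refl
    zero≢incremented : ∀ {x y} → x ∈ map (0 ∷_) (exponentVectors m (suc r)) →
                       y ∈ map incrementHead (exponentVectors (suc m) r) → x ≢ y
    zero≢incremented x∈ y∈ eq with ∈-map⁻ (0 ∷_) x∈ | ∈-map⁻ incrementHead y∈
    zero≢incremented x∈ y∈ () | _ , _ , refl | (_ ∷ _) , _ , refl

  monomial : ∀ {m} → (Fin m → ℕ) → Vec ℕ m → ℕ
  monomial f [] = 1
  monomial f (n ∷ e) = f zero ℕ.^ n ℕ.* monomial (λ i → f (suc i)) e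

  monomialℤ : ∀ {m} → (Fin m → ℤ) → Vec ℕ m → ℤ
  monomialℤ f [] = 1ℤ
  monomialℤ f (n ∷ e) = f zero ℤ.^ n ℤ.* monomialℤ (λ i → f (suc i)) e

  ^-distrib-* : ∀ x y n → (x ℤ.* y) ℤ.^ n ≡ x ℤ.^ n ℤ.* y ℤ.^ n
  ^-distrib-* x y zero = refl
  ^-distrib-* x y (suc n) = trans (cong ((x ℤ.* y) ℤ.*_) (^-distrib-* x y n)) (lem x y (x ℤ.^ n) (y ℤ.^ n))
    where lem : ∀ x y a b → x ℤ.* y ℤ.* (a ℤ.* b) ≡ x ℤ.* a ℤ.* (y ℤ.* b)
          lem = solve-∀

  pos-^ : ∀ x n → + (x ℕ.^ n) ≡ (+ x) ℤ.^ n
  pos-^ x zero = refl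
  pos-^ x (suc n) = trans (pos-* x (x ℕ.^ n)) (cong (+ x ℤ.*_) (pos-^ x n))

  abs-^ : ∀ x n → ∣ x ℤ.^ n ∣ ≡ ∣ x ∣ ℕ.^ n
  abs-^ x zero = refl
  abs-^ x (suc n) = trans (abs-* x (x ℤ.^ n)) (cong (∣ x ∣ ℕ.*_) (abs-^ x n))

  monomialℤ-* : ∀ {m} (f g : Fin m → ℤ) e → monomialℤ (λ i → f i ℤ.* g i) e ≡ monomialℤ f e ℤ.* monomialℤ g e
  monomialℤ-* f g [] = refl
  monomialℤ-* f g (n ∷ e) =
    trans (cong₂ ℤ._*_ (^-distrib-* (f zero) (g zero) n) (monomialℤ-* (λ i → f (suc i)) (λ i → g (suc i)) e))
          (lem (f zero ℤ.^ n) (g zero ℤ.^ n) _ _)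
    where lem : ∀ a b c d → a ℤ.* b ℤ.* (c ℤ.* d) ≡ a ℤ.* c ℤ.* (b ℤ.* d)
          lem = solve-∀

  monomialℤ-^ : ∀ {m} (f : Fin m → ℤ) e t → monomialℤ f e ℤ.^ t ≡ monomialℤ (λ i → f i ℤ.^ t) e
  monomialℤ-^ f [] t = ^-zeroˡ t
  monomialℤ-^ f (n ∷ e) t = trans (^-distrib-* (f zero ℤ.^ n) (monomialℤ (λ i → f (suc i)) e) t)
    (cong₂ ℤ._*_ (trans (^-*-assoc (f zero) n t) (trans (cong (f zero ℤ.^_) (ℕP.*-comm n t)) (sym (^-*-assoc (f zero) t n))))
                 (monomialℤ-^ (λ i → f (suc i)) e t))

  monomialℤ-1 : ∀ {m} e → monomialℤ {m} (λ _ → 1ℤ) e ≡ 1ℤ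
  monomialℤ-1 [] = refl
  monomialℤ-1 (n ∷ e) = cong₂ ℤ._*_ (^-zeroˡ n) (monomialℤ-1 e)

  pos-monomial : ∀ {m} (f : Fin m → ℕ) e → + monomial f e ≡ monomialℤ (λ i → + f i) e
  pos-monomial f [] = refl
  pos-monomial f (n ∷ e) = trans (pos-* (f zero ℕ.^ n) _) (cong₂ ℤ._*_ (pos-^ (f zero) n) (pos-monomial (λ i → f (suc i)) e))

  abs-monomialℤ : ∀ {m} (f : Fin m → ℤ) e → ∣ monomialℤ f e ∣ ≡ monomial (λ i → ∣ f i ∣) e
  abs-monomialℤ f [] = refl
  abs-monomialℤ f (n ∷ e) = trans (abs-* (f zero ℤ.^ n) _) (cong₂ ℕ._*_ (abs-^ (f zero) n) (abs-monomialℤ (λ i → f (suc i)) e))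

  monomial≤^degree : ∀ {m} (f : Fin m → ℕ) k e → (∀ i → f i ≤ k) → monomial f e ≤ k ℕ.^ degree e
  monomial≤^degree f k [] h = ℕP.≤-refl
  monomial≤^degree f k (n ∷ e) h =
    ℕP.≤-trans (ℕP.*-mono-≤ (ℕP.^-monoˡ-≤ n (h zero)) (monomial≤^degree (λ i → f (suc i)) k e (λ i → h (suc i))))
               (ℕP.≤-reflexive (sym (ℕP.^-distribˡ-+-* k n (degree e))))

  1≤monomial : ∀ {m} (f : Fin m → ℕ) e → (∀ i → 1 ≤ f i) → 1 ≤ monomial f e
  1≤monomial f [] h = s≤s z≤n
  1≤monomial f (n ∷ e) h =
    ℕP.*-mono-≤ (ℕP.≤-trans (ℕP.≤-reflexive (sym (ℕP.^-zeroˡ n))) (ℕP.^-monoˡ-≤ n (h zero))) (1≤monomial (λ i → f (suc i)) e (λ i → h (suc i)))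

  ≈-monomialℤ : ∀ {p m} {f g : Fin m → ℤ} e → (∀ i → f i ≈ g i [mod p ]) → monomialℤ f e ≈ monomialℤ g e [mod p ]
  ≈-monomialℤ [] h = ≈-refl
  ≈-monomialℤ (n ∷ e) h = ≈-* (≈-^ n (h zero)) (≈-monomialℤ e (λ i → h (suc i)))

module RootCount where

  open import Data.Nat as ℕ using (ℕ; _<_; _≤_; NonZero)
  import Data.Nat.Properties as ℕP
  open import Data.Nat.DivMod using (_%_; _/_; m≡m%n+[m/n]*n; m%n<n)
  open import Data.Nat.Primality using (Prime; prime⇒nonZero)
  open import Data.Nat.Combinatorics using (_C_)
  open import Data.Integer using (ℤ; +_; 0ℤ; 1ℤ; _+_; _*_; _-_; -_; ∣_∣; _^_)
  open import Data.Integer.Properties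
  open import Data.Integer.Divisibility.Signed using (divides; ∣m⇒∣-m; ∣n⇒∣m*n; ∣⇒∣ᵤ) renaming (_∣_ to _∣ₛ_)
  open import Data.Integer.Tactic.RingSolver using (solve-∀)
  open import Data.Fin using (Fin)
  open import Data.Vec using (Vec)
  open import Data.List using (List; length; map)
  open import Data.List.Properties using (length-map)
  open import Data.List.Relation.Unary.All using (All)
  import Data.List.Relation.Unary.All as All
  import Data.List.Relation.Unary.All.Properties as AllP
  open import Data.List.Relation.Unary.AllPairs using (AllPairs)
  import Data.List.Relation.Unary.AllPairs as AllPairs
  import Data.List.Relation.Unary.AllPairs.Properties as AllPairsP
  open import Relation.Nullary using (¬_)
  open import Relation.Binary.PropositionalEquality
  open Lists
  open Congruence
  open Roots
  open Monomials

  module CountRootsOfUnity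
    {p : ℕ} (pr : Prime p) (t k r m : ℕ) .{{_ : NonZero t}} .{{_ : NonZero k}}
    (x : Fin m → ℕ) (a : Fin m → ℤ) (b : Fin m → ℕ)
    (x-root : ∀ i → (+ x i) ^ t ≈ 1ℤ [mod p ])
    (x-ratio : ∀ i → + b i * + x i ≈ a i [mod p ])
    (a≤k : ∀ i → ∣ a i ∣ ≤ k) (b≤k : ∀ i → b i ≤ k)
    (small : 2 ℕ.* (k ℕ.^ r ℕ.* k ℕ.^ r) < p)
    (independent : ∀ e f → monomial (λ i → ∣ a i ∣) e ℕ.* monomial b f ≡ monomial (λ i → ∣ a i ∣) f ℕ.* monomial b e → e ≡ f)
    where

    instance
      p≢0 : NonZero p
      p≢0 = prime⇒nonZero pr

    residue : Vec ℕ m → ℕ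
    residue e = monomial x e % p

    A B X : Vec ℕ m → ℤ
    A e = monomialℤ a e
    B e = monomialℤ (λ i → + b i) e
    X e = monomialℤ (λ i → + x i) e

    residue≈X : ∀ e → + residue e ≈ X e [mod p ]
    residue≈X e = ≈-mod (subst (+ p ∣ₛ_) (lem (monomial x e / p) (+ residue e) (X e) X≡)
                                (∣m⇒∣-m (∣n⇒∣m*n (+ (monomial x e / p)) (divides 1ℤ (sym (*-identityˡ (+ p)))))))
      where
      X≡ : X e ≡ + residue e + + (monomial x e / p) * + p
      X≡ = trans (sym (pos-monomial x e)) (trans (cong +_ (m≡m%n+[m/n]*n (monomial x e) p))
             (trans (pos-+ (residue e) _) (cong (_+_ (+ residue e)) (pos-* (monomial x e / p) p))))
      lem : ∀ q z Z → Z ≡ z + + q * + p → - (+ q * + p) ≡ z - Z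
      lem q z Z refl = lem′ z (+ q * + p)
        where lem′ : ∀ a b → - b ≡ a - (a + b)
              lem′ = solve-∀

    residue-root : ∀ e → evalMonic (xⁿ-1 t) (+ residue e) ≈ 0ℤ [mod p ]
    residue-root e = ∣⇒≈0 (subst (+ p ∣ₛ_) (sym (evalMonic-xⁿ-1 t (+ residue e))) (∣-difference residueᵗ≈1))
      where
      residueᵗ≈1 : (+ residue e) ^ t ≈ 1ℤ [mod p ]
      residueᵗ≈1 = ≈-trans (≈-^ t (residue≈X e))
        (≈-trans (≈-reflexive (monomialℤ-^ (λ i → + x i) e t))
          (≈-trans (≈-monomialℤ e x-root) (≈-reflexive (monomialℤ-1 e))))

    A≈BX : ∀ e → A e ≈ B e * X e [mod p ]
    A≈BX e = ≈-trans (≈-monomialℤ e (λ i → ≈-sym (x-ratio i))) (≈-reflexive (monomialℤ-* (λ i → + b i) (λ i → + x i) e))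

    ∣monomial∣≤ : ∀ (f : Fin m → ℤ) e → (∀ i → ∣ f i ∣ ≤ k) → degree e ≤ r → ∣ monomialℤ f e ∣ ≤ k ℕ.^ r
    ∣monomial∣≤ f e f≤k deg≤r = ℕP.≤-trans (ℕP.≤-reflexive (abs-monomialℤ f e))
      (ℕP.≤-trans (monomial≤^degree (λ i → ∣ f i ∣) k e f≤k) (ℕP.^-monoʳ-≤ k deg≤r))

    ∣AB∣≤ : ∀ e f → degree e ≤ r → degree f ≤ r → ∣ A e * B f ∣ ≤ k ℕ.^ r ℕ.* k ℕ.^ r
    ∣AB∣≤ e f deg-e deg-f = ℕP.≤-trans (ℕP.≤-reflexive (abs-* (A e) (B f)))
      (ℕP.*-mono-≤ (∣monomial∣≤ a e a≤k deg-e) (∣monomial∣≤ (λ i → + b i) f b≤k deg-f))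

    residue-injective : ∀ e f → degree e ≤ r → degree f ≤ r → residue e ≡ residue f → e ≡ f
    residue-injective e f deg-e deg-f res≡ = independent e f (begin
      monomial (λ i → ∣ a i ∣) e ℕ.* monomial b f  ≡⟨ cong₂ ℕ._*_ (abs-monomialℤ a e) (abs-monomialℤ (λ i → + b i) f) ⟨
      ∣ A e ∣ ℕ.* ∣ B f ∣                          ≡⟨ abs-* (A e) (B f) ⟨
      ∣ A e * B f ∣                                ≡⟨ cong ∣_∣ AB≡ ⟩
      ∣ A f * B e ∣                                ≡⟨ abs-* (A f) (B e) ⟩
      ∣ A f ∣ ℕ.* ∣ B e ∣                          ≡⟨ cong₂ ℕ._*_ (abs-monomialℤ a f) (abs-monomialℤ (λ i → + b i) e) ⟩
      monomial (λ i → ∣ a i ∣) f ℕ.* monomial b e  ∎)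
      where
      open ≡-Reasoning
      Xe≈Xf : X e ≈ X f [mod p ]
      Xe≈Xf = ≈-trans (≈-sym (residue≈X e)) (subst (λ z → + z ≈ X f [mod p ]) (sym res≡) (residue≈X f))
      AB≈ : A e * B f ≈ A f * B e [mod p ]
      AB≈ = ≈-trans step₁ (≈-trans step₂ (≈-trans (≈-reflexive (lem (B e) (X f) (B f))) step₃))
        where
        step₁ : A e * B f ≈ B e * X e * B f [mod p ]
        step₁ = ≈-* (A≈BX e) (≈-refl {a = B f})
        step₂ : B e * X e * B f ≈ B e * X f * B f [mod p ]
        step₂ = ≈-* (≈-* (≈-refl {a = B e}) Xe≈Xf) (≈-refl {a = B f})
        step₃ : B f * X f * B e ≈ A f * B e [mod p ]
        step₃ = ≈-* (≈-sym (A≈BX f)) (≈-refl {a = B e})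
        lem : ∀ x y w → x * y * w ≡ w * y * x
        lem = solve-∀
      difference<p : ∣ A e * B f - A f * B e ∣ < p
      difference<p = ℕP.≤-<-trans (∣i-j∣≤∣i∣+∣j∣ (A e * B f) (A f * B e))
        (ℕP.≤-<-trans (ℕP.+-mono-≤ (∣AB∣≤ e f deg-e deg-f) (∣AB∣≤ f e deg-f deg-e))
                      (subst (_< p) (cong (k ℕ.^ r ℕ.* k ℕ.^ r ℕ.+_) (ℕP.+-identityʳ (k ℕ.^ r ℕ.* k ℕ.^ r))) small))
      AB≡ : A e * B f ≡ A f * B e
      AB≡ = i-j≡0⇒i≡j _ _ (∣i∣≡0⇒i≡0 (∣n∣<p⇒n≡0 (∣⇒∣ᵤ (∣-difference AB≈)) difference<p))

    residues : List ℕ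
    residues = map residue (exponentVectors m r)

    residues-distinct : AllPairs (λ u v → ¬ (+ u ≈ + v [mod p ])) residues
    residues-distinct = AllPairsP.map⁺ (AllPairs-mapWithAll residue-≉ (exponentVectors-degree m r) (exponentVectors-distinct m r))
      where
      residue-≉ : ∀ {e f} → degree e ≤ r → degree f ≤ r → e ≢ f → ¬ (+ residue e ≈ + residue f [mod p ])
      residue-≉ {e} {f} deg-e deg-f e≢f ≈ = e≢f (residue-injective e f deg-e deg-f (≈-residue⇒≡ _ _ (m%n<n _ p) (m%n<n _ p) ≈))

    binomial≤t : (r ℕ.+ m) C m ≤ t
    binomial≤t = begin
      (r ℕ.+ m) C m                  ≡⟨ length-exponentVectors m r ⟨
      length (exponentVectors m r)   ≡⟨ length-map residue (exponentVectors m r) ⟨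
      length residues                ≡⟨ length-map +_ residues ⟨
      length (map +_ residues)       ≤⟨ roots≤degree pr (xⁿ-1 t) (map +_ residues) (AllPairsP.map⁺ residues-distinct)
                                          (AllP.map⁺ (AllP.map⁺ (All.tabulate (λ {e} _ → residue-root e)))) ⟩
      length (xⁿ-1 t)                ≡⟨ length-xⁿ-1 t ⟩
      t                              ∎
      where open ℕP.≤-Reasoning

module Convolution where

  open import Data.Nat
  open import Data.Nat.Properties
  open import Data.Nat.Tactic.RingSolver using (solve-∀)
  open import Data.Nat.Combinatorics using (_C_; nCk+nC[k+1]≡[n+1]C[k+1])
  open import Data.Nat.Combinatorics.Specification using (k>n⇒nCk≡0)
  open import Data.Product using (_,_)
  open import Relation.Binary.PropositionalEquality
  open import Defs
  open Primes

  sumTo-cong : ∀ n (f g : ℕ → ℕ) → (∀ l → l ≤ n → f l ≡ g l) → sumTo n f ≡ sumTo n g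
  sumTo-cong zero f g h = h 0 z≤n
  sumTo-cong (suc n) f g h = cong₂ _+_ (sumTo-cong n f g (λ l l≤n → h l (m≤n⇒m≤1+n l≤n))) (h (suc n) ≤-refl)

  sumTo-mono-≤ : ∀ n (f g : ℕ → ℕ) → (∀ l → l ≤ n → f l ≤ g l) → sumTo n f ≤ sumTo n g
  sumTo-mono-≤ zero f g h = h 0 z≤n
  sumTo-mono-≤ (suc n) f g h = +-mono-≤ (sumTo-mono-≤ n f g (λ l l≤n → h l (m≤n⇒m≤1+n l≤n))) (h (suc n) ≤-refl)

  sumTo-distrib-+ : ∀ n (f g : ℕ → ℕ) → sumTo n (λ l → f l + g l) ≡ sumTo n f + sumTo n g
  sumTo-distrib-+ zero f g = refl
  sumTo-distrib-+ (suc n) f g = trans (cong (_+ (f (suc n) + g (suc n))) (sumTo-distrib-+ n f g))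
    (+-+-comm (sumTo n f) (sumTo n g) (f (suc n)) (g (suc n)))
    where +-+-comm : ∀ a b c d → a + b + (c + d) ≡ a + c + (b + d)
          +-+-comm = solve-∀

  sumTo-suc : ∀ n (f : ℕ → ℕ) → sumTo (suc n) f ≡ f 0 + sumTo n (λ l → f (suc l))
  sumTo-suc zero f = refl
  sumTo-suc (suc n) f = trans (cong (_+ f (suc (suc n))) (sumTo-suc n f)) (+-assoc (f 0) _ _)

  binomialSum : ℕ → (ℕ → ℕ → ℕ) → ℕ
  binomialSum m h = sumTo m (λ l → (m C l) * h l (m ∸ l))

  binomialSum-cong : ∀ m h h′ → (∀ a b → h a b ≡ h′ a b) → binomialSum m h ≡ binomialSum m h′
  binomialSum-cong m h h′ e = sumTo-cong m _ _ (λ l _ → cong ((m C l) *_) (e l (m ∸ l)))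

  binomialSum-mono-≤ : ∀ m h h′ → (∀ a b → h a b ≤ h′ a b) → binomialSum m h ≤ binomialSum m h′
  binomialSum-mono-≤ m h h′ le = sumTo-mono-≤ m _ _ (λ l _ → *-monoʳ-≤ (m C l) (le l (m ∸ l)))

  binomialSum-suc : ∀ m h → binomialSum (suc m) h ≡ binomialSum m (λ a b → h (suc a) b) + binomialSum m (λ a b → h a (suc b))
  binomialSum-suc m h = begin
    binomialSum (suc m) h
      ≡⟨ sumTo-suc m _ ⟩
    (suc m C 0) * h 0 (suc m) + sumTo m (λ l → (suc m C suc l) * h (suc l) (m ∸ l))
      ≡⟨ cong ((suc m C 0) * h 0 (suc m) +_) (trans (sumTo-cong m _ _ (λ l _ → pascal l)) (sumTo-distrib-+ m _ _)) ⟩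
    (suc m C 0) * h 0 (suc m) + (binomialSum m (λ a b → h (suc a) b) + R)
      ≡⟨ +-comm-left ((suc m C 0) * h 0 (suc m)) (binomialSum m (λ a b → h (suc a) b)) R ⟩
    binomialSum m (λ a b → h (suc a) b) + ((suc m C 0) * h 0 (suc m) + R)
      ≡⟨ cong (binomialSum m (λ a b → h (suc a) b) +_) (right m) ⟩
    binomialSum m (λ a b → h (suc a) b) + binomialSum m (λ a b → h a (suc b)) ∎
    where
    open ≡-Reasoning
    R = sumTo m (λ l → (m C suc l) * h (suc l) (m ∸ l))
    pascal : ∀ l → (suc m C suc l) * h (suc l) (m ∸ l) ≡ (m C l) * h (suc l) (m ∸ l) + (m C suc l) * h (suc l) (m ∸ l)
    pascal l = trans (cong (_* h (suc l) (m ∸ l)) (sym (nCk+nC[k+1]≡[n+1]C[k+1] m l))) (*-distribʳ-+ (h (suc l) (m ∸ l)) (m C l) (m C suc l))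
    +-comm-left : ∀ a b c → a + (b + c) ≡ b + (a + c)
    +-comm-left = solve-∀
    right : ∀ m → (suc m C 0) * h 0 (suc m) + sumTo m (λ l → (m C suc l) * h (suc l) (m ∸ l)) ≡ binomialSum m (λ a b → h a (suc b))
    right zero = +-identityʳ _
    right (suc m′) = begin
      1 * h 0 (suc (suc m′)) + (sumTo m′ F + (suc m′ C suc (suc m′)) * h (suc (suc m′)) (suc m′ ∸ suc m′))
        ≡⟨ cong (λ z → 1 * h 0 (suc (suc m′)) + (sumTo m′ F + z * h (suc (suc m′)) (suc m′ ∸ suc m′))) (k>n⇒nCk≡0 (n<1+n (suc m′))) ⟩
      1 * h 0 (suc (suc m′)) + (sumTo m′ F + 0)
        ≡⟨ cong (1 * h 0 (suc (suc m′)) +_) (trans (+-identityʳ _)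
             (sumTo-cong m′ _ _ (λ l l≤m′ → cong (λ z → (suc m′ C suc l) * h (suc l) z) (+-∸-assoc 1 l≤m′)))) ⟩
      (suc m′ C 0) * h 0 (suc (suc m′)) + sumTo m′ (λ l → (suc m′ C suc l) * h (suc l) (suc (m′ ∸ l)))
        ≡⟨ sumTo-suc m′ _ ⟨
      binomialSum (suc m′) (λ a b → h a (suc b)) ∎
      where F = λ l → (suc m′ C suc l) * h (suc l) (suc m′ ∸ l)

  binomialSum-monoˡ-≤ : ∀ h → (∀ a b → h a b ≤ h a (suc b)) → ∀ {m s} → m ≤ s → binomialSum m h ≤ binomialSum s h
  binomialSum-monoˡ-≤ h h-mono {m} m≤s with m≤n⇒∃[o]m+o≡n m≤s
  ... | o , refl = go o
    where
    step : ∀ n → binomialSum n h ≤ binomialSum (suc n) h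
    step n = ≤-trans (binomialSum-mono-≤ n h (λ a b → h a (suc b)) h-mono)
                     (≤-trans (m≤n+m _ _) (≤-reflexive (sym (binomialSum-suc n h))))
    go : ∀ o → binomialSum m h ≤ binomialSum (m + o) h
    go zero = ≤-reflexive (cong (λ z → binomialSum z h) (sym (+-identityʳ m)))
    go (suc o) = ≤-trans (go o) (≤-trans (step (m + o)) (≤-reflexive (cong (λ z → binomialSum z h) (sym (+-suc m o)))))

  module _ (P : ℕ → ℕ) (isP : IsPrimeEnum P) (k : ℕ) where
    open Enumeration P isP

    Φ̃≡binomialSum : ∀ m → Φ̃ P k m ≡ binomialSum m (λ a b → Ψp P k a * Ψp P k b)
    Φ̃≡binomialSum m = sumTo-cong m _ _ (λ l _ → *-assoc (m C l) (Ψp P k l) (Ψp P k (m ∸ l)))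

    Φ̃-mono : 1 ≤ k → ∀ {m s} → m ≤ s → Φ̃ P k m ≤ Φ̃ P k s
    Φ̃-mono 1≤k {m} {s} m≤s = begin
      Φ̃ P k m                                           ≡⟨ Φ̃≡binomialSum m ⟩
      binomialSum m (λ a b → Ψp P k a * Ψp P k b)       ≤⟨ binomialSum-monoˡ-≤ _ (λ a b → *-monoʳ-≤ (Ψp P k a) (Ψp-suc-mono k 1≤k b)) m≤s ⟩
      binomialSum s (λ a b → Ψp P k a * Ψp P k b)       ≡⟨ Φ̃≡binomialSum s ⟨
      Φ̃ P k s                                           ∎
      where open ≤-Reasoning

module Encoding where

  open import Data.Bool using (Bool; true; false)
  open import Data.Nat
  open import Data.Nat.Properties
  open import Data.Nat.Divisibility using (_∣_; ∣1⇒≡1; ∣⇒≤)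
  open import Data.Nat.Primality using (Prime; euclidsLemma)
  open import Data.Integer as ℤ using (ℤ; +_; -_)
  import Data.Integer.Properties as ℤP
  open import Data.List using (List; []; _∷_; map; _++_; length; cartesianProductWith)
  open import Data.List.Properties using (length-++; length-map; ∷-injectiveʳ)
  open import Data.List.Membership.Propositional using (_∈_)
  open import Data.List.Membership.Propositional.Properties using (∈-map⁺; ∈-++⁺ˡ; ∈-++⁺ʳ; ∈-cartesianProductWith⁺)
  open import Data.List.Relation.Unary.Any using (here)
  open import Data.List.Relation.Unary.All using (All; []; _∷_)
  import Data.List.Relation.Unary.All as All
  import Data.List.Relation.Unary.All.Properties as AllP
  open import Data.List.Relation.Unary.AllPairs using (AllPairs)
  import Data.List.Relation.Unary.AllPairs as AllPairs
  import Data.List.Relation.Unary.AllPairs.Properties as AllPairsP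
  open import Data.Product using (Σ; _×_; _,_; proj₁; proj₂)
  open import Data.Sum using (inj₁; inj₂)
  open import Data.Empty using (⊥-elim)
  open import Relation.Nullary using (¬_; yes; no; Dec)
  open import Relation.Binary.PropositionalEquality
  open import Defs
  open Lists
  open Multiplicity
  open Primes
  open Convolution

  +m-+n≡+[m∸n] : ∀ m n → n ≤ m → + m ℤ.- + n ≡ + (m ∸ n)
  +m-+n≡+[m∸n] m n n≤m = trans (ℤP.[+m]-[+n]≡m⊖n m n) (ℤP.⊖-≥ n≤m)

  +m-+n≡-[n∸m] : ∀ m n → m ≤ n → + m ℤ.- + n ≡ - + (n ∸ m)
  +m-+n≡-[n∸m] m n m≤n = trans (ℤP.[+m]-[+n]≡m⊖n m n) (ℤP.⊖-≤ m≤n)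

  prime∣m^n⇒prime∣m : ∀ {q} m n → Prime q → q ∣ m ^ n → q ∣ m
  prime∣m^n⇒prime∣m m zero pq q∣1 = ⊥-elim (<-irrefl refl (≤-trans (prime⇒2≤ pq) (≤-reflexive (∣1⇒≡1 q∣1))))
  prime∣m^n⇒prime∣m m (suc n) pq q∣mᵐ⁺¹ with euclidsLemma m (m ^ n) pq q∣mᵐ⁺¹
  ... | inj₁ q∣m = q∣m
  ... | inj₂ q∣mⁿ = prime∣m^n⇒prime∣m m n pq q∣mⁿ

  length-cartesianProductWith : ∀ {A B C : Set} (f : A → B → C) xs ys → length (cartesianProductWith f xs ys) ≡ length xs * length ys
  length-cartesianProductWith f [] ys = refl
  length-cartesianProductWith f (x ∷ xs) ys =
    trans (length-++ (map (f x) ys)) (cong₂ _+_ (length-map (f x) ys) (length-cartesianProductWith f xs ys))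

  #true+ : List Bool → ℕ → ℕ
  #true+ [] i = i
  #true+ (true ∷ bs) i = #true+ bs (suc i)
  #true+ (false ∷ bs) i = #true+ bs i

  #false+ : List Bool → ℕ → ℕ
  #false+ [] j = j
  #false+ (true ∷ bs) j = #false+ bs j
  #false+ (false ∷ bs) j = #false+ bs (suc j)

  ≤#true+ : ∀ bs i → i ≤ #true+ bs i
  ≤#true+ [] i = ≤-refl
  ≤#true+ (true ∷ bs) i = ≤-trans (n≤1+n i) (≤#true+ bs (suc i))
  ≤#true+ (false ∷ bs) i = ≤#true+ bs i

  ≤#false+ : ∀ bs j → j ≤ #false+ bs j
  ≤#false+ [] j = ≤-refl
  ≤#false+ (true ∷ bs) j = ≤#false+ bs j
  ≤#false+ (false ∷ bs) j = ≤-trans (n≤1+n j) (≤#false+ bs (suc j))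

  record Code : Set where
    constructor code
    field
      signs : List Bool
      numer denom : ℕ
  open Code

  prependSign : Bool → Code → Code
  prependSign b c = record c { signs = b ∷ signs c }

  module CodeCount (P : ℕ → ℕ) (isP : IsPrimeEnum P) (k : ℕ) where
    open Enumeration P isP

    PrimeFactorsIn : ℕ → ℕ → ℕ → Set
    PrimeFactorsIn n lo hi = ∀ q → Prime q → q ∣ n → Σ ℕ λ l → (lo < l × l ≤ hi) × q ≡ P l

    PrimeFactorsIn-1 : ∀ lo hi → PrimeFactorsIn 1 lo hi
    PrimeFactorsIn-1 lo hi q pq q∣1 = ⊥-elim (<-irrefl refl (≤-trans (prime⇒2≤ pq) (≤-reflexive (∣1⇒≡1 q∣1))))

    PrimeFactorsIn-* : ∀ i w n hi → suc i ≤ hi → PrimeFactorsIn n (suc i) hi → PrimeFactorsIn (P (suc i) ^ w * n) i hi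
    PrimeFactorsIn-* i w n hi i<hi h q pq q∣ with euclidsLemma (P (suc i) ^ w) n pq q∣
    ... | inj₁ q∣Pʷ = suc i , (≤-refl , i<hi) , prime∣prime⇒≡ pq (P-prime (suc i) (s≤s z≤n)) (prime∣m^n⇒prime∣m (P (suc i)) w pq q∣Pʷ)
    ... | inj₂ q∣n with h q pq q∣n
    ...   | l , (i+1<l , l≤hi) , q≡ = l , (<-trans (n<1+n i) i+1<l , l≤hi) , q≡

    P∤ : ∀ n i hi → PrimeFactorsIn n (suc i) hi → ¬ (P (suc i) ∣ n)
    P∤ n i hi h P∣n with h (P (suc i)) (P-prime (suc i) (s≤s z≤n)) P∣n
    ... | l , (i+1<l , _) , P≡ = <-irrefl (P-injective (suc i) l (s≤s z≤n) (≤-trans (s≤s z≤n) i+1<l) P≡) i+1<l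

    cancelPrimePower : ∀ i w w′ n n′ hi hi′ → PrimeFactorsIn n (suc i) hi → PrimeFactorsIn n′ (suc i) hi′ → 1 ≤ n → 1 ≤ n′ →
                       P (suc i) ^ w * n ≡ P (suc i) ^ w′ * n′ → w ≡ w′ × n ≡ n′
    cancelPrimePower i w w′ n n′ hi hi′ h h′ 1≤n 1≤n′ eq = w≡w′ , n≡n′
      where
      Q = P (suc i)
      2≤Q = prime⇒2≤ (P-prime (suc i) (s≤s z≤n))
      w≡w′ : w ≡ w′
      w≡w′ = trans (sym (ν-unique Q w n _ 2≤Q refl 1≤n (P∤ n i hi h))) (trans (cong (ν Q) eq) (ν-unique Q w′ n′ _ 2≤Q refl 1≤n′ (P∤ n′ i hi′ h′)))
      n≡n′ : n ≡ n′
      n≡n′ = *-cancelˡ-≡ n n′ (Q ^ w) {{>-nonZero (1≤m^n Q w (≤-trans (s≤s z≤n) 2≤Q))}} (trans eq (cong (λ z → Q ^ z * n′) (sym w≡w′)))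

    smoothList : ℕ → List ℕ
    smoothList zero = 1 ∷ []
    smoothList (suc i) = select (smoothᵇ (P (suc i))) k

    length-smoothList : ∀ i → length (smoothList i) ≡ Ψp P k i
    length-smoothList zero = refl
    length-smoothList (suc i) = length-select _ k

    ∈-smoothList : ∀ i n → 1 ≤ n → n ≤ k → PrimeFactorsIn n 0 i → n ∈ smoothList i
    ∈-smoothList zero (suc zero) _ _ _ = here refl
    ∈-smoothList zero (suc (suc n)) _ _ h with primeDivisor (suc (suc n)) (s≤s (s≤s z≤n))
    ... | q , pq , q∣ with h q pq q∣
    ...   | l , (1≤l , l≤0) , _ = ⊥-elim (<-irrefl refl (≤-trans 1≤l l≤0))
    ∈-smoothList (suc i) n 1≤n n≤k h = ∈-select _ k n 1≤n n≤k (smoothᵇ-complete (P (suc i)) n factors≤)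
      where
      factors≤ : ∀ q → Prime q → q ∣ n → q ≤ P (suc i)
      factors≤ q pq q∣n with h q pq q∣n
      ... | l , (1≤l , l≤i) , refl = P-mono l (suc i) 1≤l l≤i

    -- All codes with m signs whose numerator is a P (i + #positive)-smooth number ≤ k and
    -- whose denominator is a P (j + #negative)-smooth number ≤ k.
    codes : ℕ → ℕ → ℕ → List Code
    codes zero i j = cartesianProductWith (code []) (smoothList i) (smoothList j)
    codes (suc m) i j = map (prependSign true) (codes m (suc i) j) ++ map (prependSign false) (codes m i (suc j))

    ∈-codes : ∀ bs i j n₁ n₂ → n₁ ∈ smoothList (#true+ bs i) → n₂ ∈ smoothList (#false+ bs j) → code bs n₁ n₂ ∈ codes (length bs) i j
    ∈-codes [] i j n₁ n₂ n₁∈ n₂∈ = ∈-cartesianProductWith⁺ (code []) n₁∈ n₂∈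
    ∈-codes (true ∷ bs) i j n₁ n₂ n₁∈ n₂∈ = ∈-++⁺ˡ (∈-map⁺ (prependSign true) (∈-codes bs (suc i) j n₁ n₂ n₁∈ n₂∈))
    ∈-codes (false ∷ bs) i j n₁ n₂ n₁∈ n₂∈ =
      ∈-++⁺ʳ (map (prependSign true) (codes (length bs) (suc i) j)) (∈-map⁺ (prependSign false) (∈-codes bs i (suc j) n₁ n₂ n₁∈ n₂∈))

    length-codes : ∀ m i j → length (codes m i j) ≡ binomialSum m (λ a b → Ψp P k (i + a) * Ψp P k (j + b))
    length-codes zero i j = begin
      length (cartesianProductWith (code []) (smoothList i) (smoothList j)) ≡⟨ length-cartesianProductWith (code []) (smoothList i) (smoothList j) ⟩
      length (smoothList i) * length (smoothList j)                       ≡⟨ cong₂ _*_ (length-smoothList i) (length-smoothList j) ⟩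
      Ψp P k i * Ψp P k j                                                 ≡⟨ cong₂ (λ x y → Ψp P k x * Ψp P k y) (+-identityʳ i) (+-identityʳ j) ⟨
      Ψp P k (i + 0) * Ψp P k (j + 0)                                     ≡⟨ +-identityʳ _ ⟨
      binomialSum 0 (λ a b → Ψp P k (i + a) * Ψp P k (j + b))             ∎
      where open ≡-Reasoning
    length-codes (suc m) i j = begin
      length (map (prependSign true) (codes m (suc i) j) ++ map (prependSign false) (codes m i (suc j)))
        ≡⟨ length-++ (map (prependSign true) (codes m (suc i) j)) ⟩
      length (map (prependSign true) (codes m (suc i) j)) + length (map (prependSign false) (codes m i (suc j)))
        ≡⟨ cong₂ _+_ (length-map _ (codes m (suc i) j)) (length-map _ (codes m i (suc j))) ⟩
      length (codes m (suc i) j) + length (codes m i (suc j))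
        ≡⟨ cong₂ _+_ (length-codes m (suc i) j) (length-codes m i (suc j)) ⟩
      binomialSum m (λ a b → Ψp P k (suc i + a) * Ψp P k (j + b)) + binomialSum m (λ a b → Ψp P k (i + a) * Ψp P k (suc j + b))
        ≡⟨ cong₂ _+_ (binomialSum-cong m _ _ (λ a b → cong (λ x → Ψp P k x * Ψp P k (j + b)) (sym (+-suc i a))))
                     (binomialSum-cong m _ _ (λ a b → cong (λ x → Ψp P k (i + a) * Ψp P k x) (sym (+-suc j b)))) ⟩
      binomialSum m (λ a b → Ψp P k (i + suc a) * Ψp P k (j + b)) + binomialSum m (λ a b → Ψp P k (i + a) * Ψp P k (j + suc b))
        ≡⟨ binomialSum-suc m (λ a b → Ψp P k (i + a) * Ψp P k (j + b)) ⟨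
      binomialSum (suc m) (λ a b → Ψp P k (i + a) * Ψp P k (j + b)) ∎
      where open ≡-Reasoning

    να νβ : ℕ → ℕ × ℕ → ℕ
    να l (α , β) = ν (P l) α
    νβ l (α , β) = ν (P l) β

    νdiff : ℕ → ℕ × ℕ → ℤ
    νdiff l u = + να l u ℤ.- + νβ l u

    -- The l-th entry of the signature of u = (α, β) goes to the numerator, as a power of the next unused
    -- small prime P (i + 1), when positive, and to the denominator, as a power of P (j + 1), otherwise.
    mutual
      encode : List ℕ → ℕ → ℕ → ℕ × ℕ → Code
      encode [] i j u = code [] 1 1
      encode (l ∷ ls) i j u = encodeStep l ls i j u (νβ l u <? να l u)

      encodeStep : ∀ l → List ℕ → ℕ → ℕ → ∀ u → Dec (νβ l u < να l u) → Code
      encodeStep l ls i j u (yes _) = let c = encode ls (suc i) j u in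
        code (true ∷ signs c) (P (suc i) ^ (να l u ∸ νβ l u) * numer c) (denom c)
      encodeStep l ls i j u (no _) = let c = encode ls i (suc j) u in
        code (false ∷ signs c) (numer c) (P (suc j) ^ (νβ l u ∸ να l u) * denom c)

    length-signs-encode : ∀ ls i j u → length (signs (encode ls i j u)) ≡ length ls
    length-signs-encode [] i j u = refl
    length-signs-encode (l ∷ ls) i j u with νβ l u <? να l u
    ... | yes _ = cong suc (length-signs-encode ls (suc i) j u)
    ... | no _ = cong suc (length-signs-encode ls i (suc j) u)

    1≤numer-encode : ∀ ls i j u → 1 ≤ numer (encode ls i j u)
    1≤numer-encode [] i j u = s≤s z≤n
    1≤numer-encode (l ∷ ls) i j u with νβ l u <? να l u
    ... | yes _ = 1≤m*n _ _ (1≤m^n _ (να l u ∸ νβ l u) (P-pos (suc i) (s≤s z≤n))) (1≤numer-encode ls (suc i) j u)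
    ... | no _ = 1≤numer-encode ls i (suc j) u

    1≤denom-encode : ∀ ls i j u → 1 ≤ denom (encode ls i j u)
    1≤denom-encode [] i j u = s≤s z≤n
    1≤denom-encode (l ∷ ls) i j u with νβ l u <? να l u
    ... | yes _ = 1≤denom-encode ls (suc i) j u
    ... | no _ = 1≤m*n _ _ (1≤m^n _ (νβ l u ∸ να l u) (P-pos (suc j) (s≤s z≤n))) (1≤denom-encode ls i (suc j) u)

    numer-encode-factors : ∀ ls i j u → PrimeFactorsIn (numer (encode ls i j u)) i (#true+ (signs (encode ls i j u)) i)
    numer-encode-factors [] i j u = PrimeFactorsIn-1 i i
    numer-encode-factors (l ∷ ls) i j u with νβ l u <? να l u
    ... | yes _ = PrimeFactorsIn-* i (να l u ∸ νβ l u) _ _ (≤#true+ (signs (encode ls (suc i) j u)) (suc i)) (numer-encode-factors ls (suc i) j u)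
    ... | no _ = numer-encode-factors ls i (suc j) u

    denom-encode-factors : ∀ ls i j u → PrimeFactorsIn (denom (encode ls i j u)) j (#false+ (signs (encode ls i j u)) j)
    denom-encode-factors [] i j u = PrimeFactorsIn-1 j j
    denom-encode-factors (l ∷ ls) i j u with νβ l u <? να l u
    ... | yes _ = denom-encode-factors ls (suc i) j u
    ... | no _ = PrimeFactorsIn-* j (νβ l u ∸ να l u) _ _ (≤#false+ (signs (encode ls i (suc j) u)) (suc j)) (denom-encode-factors ls i (suc j) u)

    pivotPart : (ℕ → ℕ) → List ℕ → ℕ
    pivotPart e [] = 1
    pivotPart e (l ∷ ls) = P l ^ e l * pivotPart e ls

    1≤pivotPart : ∀ e b ls → AscendingFrom b ls → 1 ≤ pivotPart e ls
    1≤pivotPart e b [] _ = s≤s z≤n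
    1≤pivotPart e b (l ∷ ls) (b<l , asc) = 1≤m*n _ _ (1≤m^n _ (e l) (P-pos l (≤-trans (s≤s z≤n) b<l))) (1≤pivotPart e l ls asc)

    ν-pivotPart-∷ : ∀ e r l ls b → Prime r → b < l → AscendingFrom l ls → ν r (pivotPart e (l ∷ ls)) ≡ e l * ν r (P l) + ν r (pivotPart e ls)
    ν-pivotPart-∷ e r l ls b pr b<l asc = trans (ν-* r _ _ pr (1≤m^n _ (e l) 1≤Pl) (1≤pivotPart e l ls asc))
      (cong (_+ ν r (pivotPart e ls)) (ν-^ r (P l) (e l) pr 1≤Pl))
      where 1≤Pl = P-pos l (≤-trans (s≤s z≤n) b<l)

    ν-pivotPart-below : ∀ e l₀ b ls → 1 ≤ l₀ → l₀ ≤ b → AscendingFrom b ls → ν (P l₀) (pivotPart e ls) ≡ 0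
    ν-pivotPart-below e l₀ b [] _ _ _ = ν-1 (P l₀)
    ν-pivotPart-below e l₀ b (l ∷ ls) 1≤l₀ l₀≤b (b<l , asc) = begin
      ν (P l₀) (pivotPart e (l ∷ ls))                        ≡⟨ ν-pivotPart-∷ e (P l₀) l ls b pl₀ b<l asc ⟩
      e l * ν (P l₀) (P l) + ν (P l₀) (pivotPart e ls)       ≡⟨ cong₂ _+_ (cong (e l *_) (ν-distinctPrime (P l₀) (P l) pl₀ (P-prime l 1≤l) Pl₀≢Pl))
                                                                          (ν-pivotPart-below e l₀ l ls 1≤l₀ (≤-trans l₀≤b (<⇒≤ b<l)) asc) ⟩
      e l * 0 + 0                                            ≡⟨ cong (_+ 0) (*-zeroʳ (e l)) ⟩
      0                                                      ∎
      where
      open ≡-Reasoning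
      pl₀ = P-prime l₀ 1≤l₀
      1≤l = ≤-trans (s≤s z≤n) b<l
      Pl₀≢Pl : P l₀ ≢ P l
      Pl₀≢Pl eq = <-irrefl eq (P-strictMono l₀ l 1≤l₀ (≤-<-trans l₀≤b b<l))

    ν-pivotPart≤ : ∀ e γ r b ls → Prime r → AscendingFrom b ls → (∀ l → 1 ≤ l → e l ≤ ν (P l) γ) → ν r (pivotPart e ls) ≤ ν r γ
    ν-pivotPart≤ e γ r b [] pr _ h = subst (_≤ ν r γ) (sym (ν-1 r)) z≤n
    ν-pivotPart≤ e γ r b (l ∷ ls) pr (b<l , asc) h with r ≟ P l
    ... | yes refl = ≤-trans (≤-reflexive ν≡) (h l 1≤l)
      where
      1≤l = ≤-trans (s≤s z≤n) b<l
      ν≡ : ν (P l) (pivotPart e (l ∷ ls)) ≡ e l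
      ν≡ = trans (ν-pivotPart-∷ e (P l) l ls b pr b<l asc)
        (trans (cong₂ _+_ (trans (cong (e l *_) (ν-self (P l) (prime⇒2≤ pr))) (*-identityʳ (e l))) (ν-pivotPart-below e l l ls 1≤l ≤-refl asc))
               (+-identityʳ (e l)))
    ... | no r≢Pl = ≤-trans (≤-reflexive ν≡) (ν-pivotPart≤ e γ r l ls pr asc h)
      where
      ν≡ : ν r (pivotPart e (l ∷ ls)) ≡ ν r (pivotPart e ls)
      ν≡ = trans (ν-pivotPart-∷ e r l ls b pr b<l asc)
        (cong (_+ ν r (pivotPart e ls)) (trans (cong (e l *_) (ν-distinctPrime r (P l) pr (P-prime l (≤-trans (s≤s z≤n) b<l)) r≢Pl)) (*-zeroʳ (e l))))

    pivotPart∣ : ∀ e γ b ls → AscendingFrom b ls → 1 ≤ γ → (∀ l → 1 ≤ l → e l ≤ ν (P l) γ) → pivotPart e ls ∣ γ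
    pivotPart∣ e γ b ls asc 1≤γ h = ν≤⇒∣ _ γ (1≤pivotPart e b ls asc) 1≤γ (λ r pr → ν-pivotPart≤ e γ r b ls pr asc h)

    positivePart negativePart : List ℕ → ℕ × ℕ → ℕ
    positivePart ls u = pivotPart (λ l → να l u ∸ νβ l u) ls
    negativePart ls u = pivotPart (λ l → νβ l u ∸ να l u) ls

    -- Replacing P l by the smaller prime P (i + 1) can only decrease the numerator, and likewise for the denominator.
    numer-encode≤ : ∀ ls i j u → AscendingFrom (i + j) ls → numer (encode ls i j u) ≤ positivePart ls u
    numer-encode≤ [] i j u _ = ≤-refl
    numer-encode≤ (l ∷ ls) i j u (i+j<l , asc) with νβ l u <? να l u
    ... | yes _ = *-mono-≤ (^-monoˡ-≤ (να l u ∸ νβ l u) (P-mono (suc i) l (s≤s z≤n) (≤-trans (s≤s (m≤m+n i j)) i+j<l)))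
                           (numer-encode≤ ls (suc i) j u (AscendingFrom-weaken ls i+j<l asc))
    ... | no β≮α = ≤-trans (numer-encode≤ ls i (suc j) u (AscendingFrom-weaken ls (≤-reflexive (+-suc i j)) (AscendingFrom-weaken ls i+j<l asc)))
                           (≤-reflexive (sym (trans (cong (λ z → P l ^ z * positivePart ls u) (m≤n⇒m∸n≡0 (≮⇒≥ β≮α))) (+-identityʳ _))))

    denom-encode≤ : ∀ ls i j u → AscendingFrom (i + j) ls → denom (encode ls i j u) ≤ negativePart ls u
    denom-encode≤ [] i j u _ = ≤-refl
    denom-encode≤ (l ∷ ls) i j u (i+j<l , asc) with νβ l u <? να l u
    ... | yes β<α = ≤-trans (denom-encode≤ ls (suc i) j u (AscendingFrom-weaken ls i+j<l asc))
                            (≤-reflexive (sym (trans (cong (λ z → P l ^ z * negativePart ls u) (m≤n⇒m∸n≡0 (<⇒≤ β<α))) (+-identityʳ _))))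
    ... | no _ = *-mono-≤ (^-monoˡ-≤ (νβ l u ∸ να l u) (P-mono (suc j) l (s≤s z≤n) (≤-trans (s≤s (m≤n+m j i)) i+j<l)))
                          (denom-encode≤ ls i (suc j) u (AscendingFrom-weaken ls (≤-reflexive (+-suc i j)) (AscendingFrom-weaken ls i+j<l asc)))

    code-≡ : ∀ {c c′ : Code} → signs c ≡ signs c′ → numer c ≡ numer c′ → denom c ≡ denom c′ → c ≡ c′
    code-≡ refl refl refl = refl

    encode-injective : ∀ ls i j u v → encode ls i j u ≡ encode ls i j v → All (λ l → νdiff l u ≡ νdiff l v) ls
    encode-injective [] i j u v eq = []
    encode-injective (l ∷ ls) i j u v eq with νβ l u <? να l u | νβ l v <? να l v
    ... | yes β<α | yes β′<α′ = νdiff≡ ∷ encode-injective ls (suc i) j u v (code-≡ (∷-injectiveʳ (cong signs eq)) (proj₂ cancelled) (cong denom eq))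
      where
      cancelled = cancelPrimePower i _ _ _ _ _ _ (numer-encode-factors ls (suc i) j u) (numer-encode-factors ls (suc i) j v)
                    (1≤numer-encode ls (suc i) j u) (1≤numer-encode ls (suc i) j v) (cong numer eq)
      νdiff≡ : νdiff l u ≡ νdiff l v
      νdiff≡ = trans (+m-+n≡+[m∸n] (να l u) (νβ l u) (<⇒≤ β<α))
        (trans (cong +_ (proj₁ cancelled)) (sym (+m-+n≡+[m∸n] (να l v) (νβ l v) (<⇒≤ β′<α′))))
    ... | no β≮α | no β′≮α′ = νdiff≡ ∷ encode-injective ls i (suc j) u v (code-≡ (∷-injectiveʳ (cong signs eq)) (cong numer eq) (proj₂ cancelled))
      where
      cancelled = cancelPrimePower j _ _ _ _ _ _ (denom-encode-factors ls i (suc j) u) (denom-encode-factors ls i (suc j) v)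
                    (1≤denom-encode ls i (suc j) u) (1≤denom-encode ls i (suc j) v) (cong denom eq)
      νdiff≡ : νdiff l u ≡ νdiff l v
      νdiff≡ = trans (+m-+n≡-[n∸m] (να l u) (νβ l u) (≮⇒≥ β≮α))
        (trans (cong (λ z → - + z) (proj₁ cancelled)) (sym (+m-+n≡-[n∸m] (να l v) (νβ l v) (≮⇒≥ β′≮α′))))
    ... | yes _ | no _ with () ← cong signs eq
    ... | no _ | yes _ with () ← cong signs eq

    Bounded : ℕ × ℕ → Set
    Bounded (α , β) = (1 ≤ α × α ≤ k) × (1 ≤ β × β ≤ k)

    encode∈codes : ∀ ls → AscendingFrom 0 ls → ∀ u → Bounded u → encode ls 0 0 u ∈ codes (length ls) 0 0
    encode∈codes ls asc u@(α , β) ((1≤α , α≤k) , (1≤β , β≤k)) =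
      subst (λ z → c ∈ codes z 0 0) (length-signs-encode ls 0 0 u) (∈-codes (signs c) 0 0 (numer c) (denom c) numer∈ denom∈)
      where
      c = encode ls 0 0 u
      numer≤k : numer c ≤ k
      numer≤k = ≤-trans (numer-encode≤ ls 0 0 u asc)
        (≤-trans (∣⇒≤ {{>-nonZero 1≤α}} (pivotPart∣ _ α 0 ls asc 1≤α (λ l _ → m∸n≤m (να l u) (νβ l u)))) α≤k)
      denom≤k : denom c ≤ k
      denom≤k = ≤-trans (denom-encode≤ ls 0 0 u asc)
        (≤-trans (∣⇒≤ {{>-nonZero 1≤β}} (pivotPart∣ _ β 0 ls asc 1≤β (λ l _ → m∸n≤m (νβ l u) (να l u)))) β≤k)
      numer∈ : numer c ∈ smoothList (#true+ (signs c) 0)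
      numer∈ = ∈-smoothList _ (numer c) (1≤numer-encode ls 0 0 u) numer≤k (numer-encode-factors ls 0 0 u)
      denom∈ : denom c ∈ smoothList (#false+ (signs c) 0)
      denom∈ = ∈-smoothList _ (denom c) (1≤denom-encode ls 0 0 u) denom≤k (denom-encode-factors ls 0 0 u)

    count≤Φ̃ : ∀ ls → AscendingFrom 0 ls → (us : List (ℕ × ℕ)) → All Bounded us →
              AllPairs (λ u v → ¬ All (λ l → νdiff l u ≡ νdiff l v) ls) us → length us ≤ Φ̃ P k (length ls)
    count≤Φ̃ ls asc us bounded distinct = begin
      length us                                   ≡⟨ length-map (encode ls 0 0) us ⟨
      length (map (encode ls 0 0) us)             ≤⟨ distinct-⊆⇒length≤ encodings-distinct (AllP.map⁺ (All.map (encode∈codes ls asc _) bounded)) ⟩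
      length (codes (length ls) 0 0)              ≡⟨ length-codes (length ls) 0 0 ⟩
      binomialSum (length ls) (λ a b → Ψp P k a * Ψp P k b) ≡⟨ Φ̃≡binomialSum P isP k (length ls) ⟨
      Φ̃ P k (length ls)                           ∎
      where
      open ≤-Reasoning
      encodings-distinct : AllPairs _≢_ (map (encode ls 0 0) us)
      encodings-distinct = AllPairsP.map⁺ (AllPairs.map (λ {u} {v} ¬same eq → ¬same (encode-injective ls 0 0 u v eq)) distinct)

module Heights where

  open import Data.Nat as ℕ using (ℕ; zero; suc; _∸_; _≤_; _<_; _⊓_)
  import Data.Nat.Properties as ℕP
  import Data.Nat.Divisibility as ℕD
  open import Data.Nat.Primality using (Prime)
  open import Data.Integer as ℤ using (ℤ; +_; 0ℤ; _+_; _*_; _-_; -_; ∣_∣)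
  open import Data.Integer.Properties
  open import Data.Integer.Divisibility.Signed using (divides; ∣m∣n⇒∣m+n; ∣n⇒∣m*n; ∣⇒∣ᵤ) renaming (_∣_ to _∣ₛ_)
  open import Data.Integer.Tactic.RingSolver using (solve-∀)
  open import Data.Sum using (_⊎_; inj₁; inj₂)
  open import Data.Empty using (⊥-elim)
  open import Relation.Nullary using (¬_)
  open import Relation.Binary.PropositionalEquality
  open import Defs using (intHeight)
  open Congruence

  ∣i∣≡∣j∣⇒i≡±j : ∀ i j → ∣ i ∣ ≡ ∣ j ∣ → i ≡ j ⊎ i ≡ - j
  ∣i∣≡∣j∣⇒i≡±j i j eq with +∣i∣≡i⊎+∣i∣≡-i i | +∣i∣≡i⊎+∣i∣≡-i j
  ... | inj₁ i≡ | inj₁ j≡ = inj₁ (trans (sym i≡) (trans (cong +_ eq) j≡))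
  ... | inj₁ i≡ | inj₂ j≡ = inj₂ (trans (sym i≡) (trans (cong +_ eq) j≡))
  ... | inj₂ i≡ | inj₁ j≡ = inj₂ (trans (sym (neg-involutive i)) (cong -_ (trans (sym i≡) (trans (cong +_ eq) j≡))))
  ... | inj₂ i≡ | inj₂ j≡ = inj₁ (trans (sym (neg-involutive i)) (trans (cong -_ (trans (sym i≡) (trans (cong +_ eq) j≡))) (neg-involutive j)))

  intHeight-≈± : ∀ p x x′ → 1 ≤ x → x < p → 1 ≤ x′ → x′ < p →
                 + x ≈ + x′ [mod p ] ⊎ + x ≈ - + x′ [mod p ] → intHeight p x ≡ intHeight p x′
  intHeight-≈± p x x′ _ x<p _ x′<p (inj₁ x≈x′) = cong (intHeight p) (≈-residue⇒≡ x x′ x<p x′<p x≈x′)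
  intHeight-≈± p x x′ 1≤x x<p 1≤x′ x′<p (inj₂ (≈-mod p∣)) = begin
    x ⊓ (p ∸ x)               ≡⟨ ℕP.⊓-comm x (p ∸ x) ⟩
    (p ∸ x) ⊓ x               ≡⟨ cong ((p ∸ x) ⊓_) (ℕP.m∸[m∸n]≡n (ℕP.<⇒≤ x<p)) ⟨
    (p ∸ x) ⊓ (p ∸ (p ∸ x))   ≡⟨ cong (λ z → z ⊓ (p ∸ z)) x′≡p∸x ⟨
    x′ ⊓ (p ∸ x′)             ∎
    where
    open ≡-Reasoning
    p∣x+x′ : p ℕD.∣ x ℕ.+ x′
    p∣x+x′ = subst (p ℕD.∣_) (cong ∣_∣ (trans (cong (_+_ (+ x)) (neg-involutive (+ x′))) (sym (pos-+ x x′)))) (∣⇒∣ᵤ p∣)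
    -- 0 < x + x′ < 2p
    x+x′≡p : x ℕ.+ x′ ≡ p
    x+x′≡p with p∣x+x′
    ... | ℕD.divides zero eq with () ← ℕP.≤-trans (ℕP.≤-trans 1≤x (ℕP.m≤m+n x x′)) (ℕP.≤-reflexive eq)
    ... | ℕD.divides (suc zero) eq = trans eq (ℕP.+-identityʳ p)
    ... | ℕD.divides (suc (suc q)) eq = ⊥-elim (ℕP.<-irrefl refl (ℕP.<-≤-trans (ℕP.+-mono-< x<p x′<p)
            (ℕP.≤-trans (ℕP.+-monoʳ-≤ p (ℕP.m≤m+n p (q ℕ.* p))) (ℕP.≤-reflexive (sym eq)))))
    x′≡p∸x : x′ ≡ p ∸ x
    x′≡p∸x = trans (sym (ℕP.m+n∸m≡n x x′)) (cong (_∸ x) x+x′≡p)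

  ≈b*x⇒1≤∣a∣ : ∀ {p} → Prime p → ∀ a b x → 1 ≤ b → b < p → 1 ≤ x → x < p → a ≈ + b * + x [mod p ] → 1 ≤ ∣ a ∣
  ≈b*x⇒1≤∣a∣ pr (+_ (suc _)) _ _ _ _ _ _ _ = ℕ.s≤s ℕ.z≤n
  ≈b*x⇒1≤∣a∣ pr ℤ.-[1+ _ ] _ _ _ _ _ _ _ = ℕ.s≤s ℕ.z≤n
  ≈b*x⇒1≤∣a∣ pr (+_ zero) b x 1≤b b<p 1≤x x<p 0≈bx with prime-∣* pr (+ b) (+ x) (≈0⇒∣ (≈-sym 0≈bx))
  ... | inj₁ p∣b = ⊥-elim (p∤n 1≤b b<p (∣⇒∣ᵤ p∣b))
  ... | inj₂ p∣x = ⊥-elim (p∤n 1≤x x<p (∣⇒∣ᵤ p∣x))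

  equalRatio⇒equalHeight : ∀ {p} → Prime p → ∀ x x′ b b′ a a′ → 1 ≤ x → x < p → 1 ≤ x′ → x′ < p →
    1 ≤ b → b < p → 1 ≤ b′ → b′ < p →
    a ≈ + b * + x [mod p ] → a′ ≈ + b′ * + x′ [mod p ] →
    ∣ a ∣ ℕ.* b′ ≡ ∣ a′ ∣ ℕ.* b → intHeight p x ≡ intHeight p x′
  equalRatio⇒equalHeight {p} pr x x′ b b′ a a′ 1≤x x<p 1≤x′ x′<p 1≤b b<p 1≤b′ b′<p (≈-mod d) (≈-mod d′) ratio =
    intHeight-≈± p x x′ 1≤x x<p 1≤x′ x′<p (cases (∣i∣≡∣j∣⇒i≡±j (a * + b′) (a′ * + b) ∣ab′∣≡∣a′b∣))
    where
    ∣ab′∣≡∣a′b∣ : ∣ a * + b′ ∣ ≡ ∣ a′ * + b ∣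
    ∣ab′∣≡∣a′b∣ = trans (abs-* a (+ b′)) (trans ratio (sym (abs-* a′ (+ b))))
    p∤bb′ : ¬ (+ p ∣ₛ (+ b * + b′))
    p∤bb′ p∣ with prime-∣* pr (+ b) (+ b′) p∣
    ... | inj₁ p∣b = p∤n 1≤b b<p (∣⇒∣ᵤ p∣b)
    ... | inj₂ p∣b′ = p∤n 1≤b′ b′<p (∣⇒∣ᵤ p∣b′)
    cancel-bb′ : ∀ z → + p ∣ₛ (+ b * + b′) * z → + p ∣ₛ z
    cancel-bb′ z p∣ with prime-∣* pr (+ b * + b′) z p∣
    ... | inj₁ p∣bb′ = ⊥-elim (p∤bb′ p∣bb′)
    ... | inj₂ p∣z = p∣z
    cases : a * + b′ ≡ a′ * + b ⊎ a * + b′ ≡ - (a′ * + b) → + x ≈ + x′ [mod p ] ⊎ + x ≈ - + x′ [mod p ]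
    cases (inj₁ eq) = inj₁ (≈-mod (cancel-bb′ _ (subst (+ p ∣ₛ_) (sym (lem a a′ (+ b) (+ b′) (+ x) (+ x′)))
        (∣m∣n⇒∣m+n (∣m∣n⇒∣m+n (∣n⇒∣m*n (- + b′) d) (∣n⇒∣m*n (+ b) d′)) (divides 0ℤ (i≡j⇒i-j≡0 eq))))))
      where lem : ∀ a a′ b b′ x x′ → b * b′ * (x - x′) ≡ (- b′) * (a - b * x) + b * (a′ - b′ * x′) + (a * b′ - a′ * b)
            lem = solve-∀
    cases (inj₂ eq) = inj₂ (≈-mod (cancel-bb′ _ (subst (+ p ∣ₛ_) (sym (lem a a′ (+ b) (+ b′) (+ x) (+ x′)))
        (∣m∣n⇒∣m+n (∣m∣n⇒∣m+n (∣n⇒∣m*n (- + b′) d) (∣n⇒∣m*n (- + b) d′))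
                   (divides 0ℤ (trans (cong (_+ a′ * + b) eq) (+-inverseˡ (a′ * + b))))))))
      where lem : ∀ a a′ b b′ x x′ → b * b′ * (x - - x′) ≡ (- b′) * (a - b * x) + (- b) * (a′ - b′ * x′) + (a * b′ + a′ * b)
            lem = solve-∀

module Signatures where

  open import Data.Nat as ℕ using (ℕ; zero; suc; _∸_; _≤_; z≤n; s≤s)
  import Data.Nat.Properties as ℕP
  open import Data.Nat.Primality using (Prime)
  open import Data.Integer using (ℤ; +_; 0ℤ; _+_; _*_; _-_)
  open import Data.Integer.Properties using (pos-+; pos-*; +-injective; i-j≡0⇒i≡j; i≡j⇒i-j≡0)
  open import Data.Integer.Tactic.RingSolver using (solve-∀)
  open import Data.Fin using (Fin; zero; suc; toℕ; fromℕ<)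
  open import Data.Fin.Properties using (toℕ-fromℕ<)
  open import Data.Vec using (Vec; []; _∷_; lookup)
  open import Data.Vec.Properties using (tabulate∘lookup; tabulate-cong)
  open import Data.Product using (_×_; _,_)
  open import Relation.Nullary using (yes; no)
  open import Relation.Binary.PropositionalEquality
  open import Defs
  open Multiplicity
  open Primes
  open Monomials
  open Elimination using (sum)
  open Encoding

  weightedSum : ∀ {m} → (Fin m → ℕ) → Vec ℕ m → ℕ
  weightedSum h [] = 0
  weightedSum h (n ∷ e) = n ℕ.* h zero ℕ.+ weightedSum (λ i → h (suc i)) e

  ν-monomial : ∀ {m} q (g : Fin m → ℕ) e → Prime q → (∀ i → 1 ≤ g i) → ν q (monomial g e) ≡ weightedSum (λ i → ν q (g i)) e
  ν-monomial q g [] pq h = ν-1 q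
  ν-monomial q g (n ∷ e) pq h =
    trans (ν-* q _ _ pq (1≤m^n (g zero) n (h zero)) (1≤monomial (λ i → g (suc i)) e (λ i → h (suc i))))
          (cong₂ ℕ._+_ (ν-^ q (g zero) n pq (h zero)) (ν-monomial q (λ i → g (suc i)) e pq (λ i → h (suc i))))

  ∑-exponentDifference : ∀ {m} (A B : Fin m → ℕ) (e f : Vec ℕ m) →
    sum (λ i → (+ lookup e i - + lookup f i) * (+ A i - + B i))
    ≡ (+ weightedSum A e + + weightedSum B f) - (+ weightedSum A f + + weightedSum B e)
  ∑-exponentDifference A B [] [] = refl
  ∑-exponentDifference A B (n ∷ e) (n′ ∷ f) =
    trans (cong (_+_ ((+ n - + n′) * (+ A zero - + B zero))) (∑-exponentDifference (λ i → A (suc i)) (λ i → B (suc i)) e f))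
      (trans (lem (+ n) (+ n′) (+ A zero) (+ B zero) (+ wA e) (+ wB f) (+ wA f) (+ wB e))
        (sym (cong₂ _-_ (cong₂ _+_ (pos-*+ n (A zero) _) (pos-*+ n′ (B zero) _)) (cong₂ _+_ (pos-*+ n′ (A zero) _) (pos-*+ n (B zero) _)))))
    where
    wA = weightedSum (λ i → A (suc i))
    wB = weightedSum (λ i → B (suc i))
    pos-*+ : ∀ x y z → + (x ℕ.* y ℕ.+ z) ≡ + x * + y + + z
    pos-*+ x y z = trans (pos-+ (x ℕ.* y) z) (cong (_+ + z) (pos-* x y))
    lem : ∀ n n′ a b sae sbf saf sbe → (n - n′) * (a - b) + ((sae + sbf) - (saf + sbe)) ≡ (n * a + sae + (n′ * b + sbf)) - (n′ * a + saf + (n * b + sbe))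
    lem = solve-∀

  +m-+n≡+m′-+n′⇒m+n′≡m′+n : ∀ m n m′ n′ → + m - + n ≡ + m′ - + n′ → m ℕ.+ n′ ≡ m′ ℕ.+ n
  +m-+n≡+m′-+n′⇒m+n′≡m′+n m n m′ n′ eq = +-injective (begin
    + (m ℕ.+ n′)             ≡⟨ pos-+ m n′ ⟩
    + m + + n′               ≡⟨ lem₁ (+ m) (+ n) (+ n′) ⟩
    (+ m - + n) + (+ n + + n′) ≡⟨ cong (_+ (+ n + + n′)) eq ⟩
    (+ m′ - + n′) + (+ n + + n′) ≡⟨ lem₂ (+ m′) (+ n′) (+ n) ⟩
    + m′ + + n               ≡⟨ pos-+ m′ n ⟨
    + (m′ ℕ.+ n)             ∎)
    where
    open ≡-Reasoning
    lem₁ : ∀ a b b′ → a + b′ ≡ (a - b) + (b + b′)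
    lem₁ = solve-∀
    lem₂ : ∀ a′ b′ b → (a′ - b′) + (b + b′) ≡ a′ + b
    lem₂ = solve-∀

  module _ (P : ℕ → ℕ) (isP : IsPrimeEnum P) (k : ℕ) where
    open Enumeration P isP
    open CodeCount P isP k using (νdiff; Bounded)

    -- The vector of exponents of p₁, …, p_k in α/β.
    signature : ℕ × ℕ → Fin k → ℤ
    signature u c = νdiff (suc (toℕ c)) u

    -- Primes above k divide neither side; a prime q ≤ k is p_c for c = π(q).
    equalSignature⇒equalRatio : ∀ α β α′ β′ → Bounded (α , β) → Bounded (α′ , β′) →
      (∀ c → signature (α , β) c ≡ signature (α′ , β′) c) → α ℕ.* β′ ≡ α′ ℕ.* β
    equalSignature⇒equalRatio α β α′ β′ ((1≤α , α≤k) , (1≤β , β≤k)) ((1≤α′ , α′≤k) , (1≤β′ , β′≤k)) same =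
      ν-injective _ _ (1≤m*n α β′ 1≤α 1≤β′) (1≤m*n α′ β 1≤α′ 1≤β) ν-equal
      where
      ν-equal : ∀ q → Prime q → ν q (α ℕ.* β′) ≡ ν q (α′ ℕ.* β)
      ν-equal q pq with q ℕ.≤? k
      ... | yes q≤k = begin
        ν q (α ℕ.* β′)        ≡⟨ ν-* q α β′ pq 1≤α 1≤β′ ⟩
        ν q α ℕ.+ ν q β′      ≡⟨ +m-+n≡+m′-+n′⇒m+n′≡m′+n (ν q α) (ν q β) (ν q α′) (ν q β′) same-q ⟩
        ν q α′ ℕ.+ ν q β      ≡⟨ ν-* q α′ β pq 1≤α′ 1≤β ⟨
        ν q (α′ ℕ.* β)        ∎
        where
        open ≡-Reasoning
        l = primeCount q
        1≤l = primeCount-pos q pq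
        l∸1+1≡l : suc (l ∸ 1) ≡ l
        l∸1+1≡l = trans (ℕP.+-comm 1 (l ∸ 1)) (ℕP.m∸n+n≡m 1≤l)
        c : Fin k
        c = fromℕ< (ℕP.≤-trans (ℕP.≤-reflexive l∸1+1≡l) (ℕP.≤-trans (count≤n _ q) q≤k))
        P[c+1]≡q : P (suc (toℕ c)) ≡ q
        P[c+1]≡q = trans (cong P (trans (cong suc (toℕ-fromℕ< _)) l∸1+1≡l)) (P-primeCount q pq)
        same-q : + ν q α - + ν q β ≡ + ν q α′ - + ν q β′
        same-q = subst (λ z → + ν z α - + ν z β ≡ + ν z α′ - + ν z β′) P[c+1]≡q (same c)
      ... | no q≰k = begin
        ν q (α ℕ.* β′)        ≡⟨ ν-* q α β′ pq 1≤α 1≤β′ ⟩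
        ν q α ℕ.+ ν q β′      ≡⟨ cong₂ ℕ._+_ (ν≡0 α 1≤α α≤k) (ν≡0 β′ 1≤β′ β′≤k) ⟩
        0                   ≡⟨ cong₂ ℕ._+_ (ν≡0 α′ 1≤α′ α′≤k) (ν≡0 β 1≤β β≤k) ⟨
        ν q α′ ℕ.+ ν q β      ≡⟨ ν-* q α′ β pq 1≤α′ 1≤β ⟨
        ν q (α′ ℕ.* β)        ∎
        where
        open ≡-Reasoning
        ν≡0 : ∀ n → 1 ≤ n → n ≤ k → ν q n ≡ 0
        ν≡0 n 1≤n n≤k = n<q⇒ν≡0 q n 1≤n (ℕP.≤-<-trans n≤k (ℕP.≰⇒> q≰k))

    -- Taking ν at p_c of both sides gives ∑ᵢ (eᵢ - fᵢ) signatureᵢ c = 0.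
    independentSignatures⇒monomial-injective : ∀ {m} (α β : Fin m → ℕ) → (∀ i → 1 ≤ α i) → (∀ i → 1 ≤ β i) →
      (∀ (w : Fin m → ℤ) → (∀ c → sum (λ i → w i * signature (α i , β i) c) ≡ 0ℤ) → ∀ i → w i ≡ 0ℤ) →
      ∀ e f → monomial α e ℕ.* monomial β f ≡ monomial α f ℕ.* monomial β e → e ≡ f
    independentSignatures⇒monomial-injective α β 1≤α 1≤β independent e f eq =
      trans (sym (tabulate∘lookup e)) (trans (tabulate-cong lookups≡) (tabulate∘lookup f))
      where
      relation : ∀ c → sum (λ i → (+ lookup e i - + lookup f i) * signature (α i , β i) c) ≡ 0ℤ
      relation c = trans (∑-exponentDifference (λ i → ν q (α i)) (λ i → ν q (β i)) e f)
        (i≡j⇒i-j≡0 (trans (sym (pos-+ (wα e) (wβ f))) (trans (cong +_ sums≡) (pos-+ (wα f) (wβ e)))))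
        where
        q = P (suc (toℕ c))
        wα = weightedSum (λ i → ν q (α i))
        wβ = weightedSum (λ i → ν q (β i))
        pq = P-prime (suc (toℕ c)) (s≤s z≤n)
        ν-side : ∀ e f → ν q (monomial α e ℕ.* monomial β f) ≡ weightedSum (λ i → ν q (α i)) e ℕ.+ weightedSum (λ i → ν q (β i)) f
        ν-side e f = trans (ν-* q _ _ pq (1≤monomial α e 1≤α) (1≤monomial β f 1≤β)) (cong₂ ℕ._+_ (ν-monomial q α e pq 1≤α) (ν-monomial q β f pq 1≤β))
        sums≡ : weightedSum (λ i → ν q (α i)) e ℕ.+ weightedSum (λ i → ν q (β i)) f ≡ weightedSum (λ i → ν q (α i)) f ℕ.+ weightedSum (λ i → ν q (β i)) e
        sums≡ = trans (sym (ν-side e f)) (trans (cong (ν q) eq) (ν-side f e))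
      lookups≡ : ∀ i → lookup e i ≡ lookup f i
      lookups≡ i = +-injective (i-j≡0⇒i≡j _ _ (independent (λ i → + lookup e i - + lookup f i) relation i))

open import Data.Nat as ℕ using (ℕ; suc; _+_; _∸_; _≤_; _<_; _*_; _^_; NonZero)
import Data.Nat.Properties as ℕP
open import Data.Nat.Tactic.RingSolver using (solve-∀)
import Data.Nat.Divisibility as ℕD
open import Data.Nat.Divisibility using (_∣_)
open import Data.Nat.Primality using (Prime; prime[2])
open import Data.Integer as ℤ using (ℤ; +_; 1ℤ)
import Data.Integer.Properties as ℤP
open import Data.Integer.Divisibility.Signed using (∣ᵤ⇒∣)
open import Data.Fin using (Fin)
open import Data.List using (List; []; _∷_; length; map)
import Data.List.Properties as LP
open import Data.List.Membership.Propositional using (_∈_)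
open import Data.List.Relation.Unary.All using (All; []; _∷_)
import Data.List.Relation.Unary.All as All
import Data.List.Relation.Unary.All.Properties as AllP
open import Data.List.Relation.Unary.AllPairs using (AllPairs)
import Data.List.Relation.Unary.AllPairs.Properties as AllPairsP
open import Data.List.Relation.Unary.Unique.Propositional using (Unique)
open import Data.Product using (Σ; _×_; _,_; proj₁; proj₂)
open import Relation.Nullary using (¬_)
open import Relation.Binary.PropositionalEquality
open import Defs
open Lists
open Multiplicity
open Primes
open Elimination
open Congruence
open Monomials
open RootCount
open Convolution
open Encoding
open Heights
open Signatures

map-proj₁-toList : ∀ {A : Set} {Q : A → Set} {xs} (qs : All Q xs) → map proj₁ (All.toList qs) ≡ xs
map-proj₁-toList [] = refl
map-proj₁-toList (q ∷ qs) = cong (_ ∷_) (map-proj₁-toList qs)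

module Points (P : ℕ → ℕ) (isP : IsPrimeEnum P) (p t k : ℕ) (pp : Prime p) (k<p : k < p) where
  open CodeCount P isP k using (Bounded; νdiff)

  Point : Set
  Point = Σ ℕ (InHeightSet p t k)

  height residue denominator : Point → ℕ
  height (h , _) = h
  residue (_ , x , _) = x
  denominator (_ , _ , _ , (a , b , _) , _) = b

  numerator : Point → ℤ
  numerator (_ , _ , _ , (a , _) , _) = a

  ratio : Point → ℕ × ℕ
  ratio w = ℤ.∣ numerator w ∣ , denominator w

  numerator≈ : ∀ w → numerator w ≈ + denominator w ℤ.* + residue w [mod p ]
  numerator≈ (_ , _ , _ , (_ , _ , _ , _ , _ , p∣) , _) = ≈-mod (∣ᵤ⇒∣ p∣)

  residue-root : ∀ w → (+ residue w) ℤ.^ t ≈ 1ℤ [mod p ]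
  residue-root (_ , x , (1≤x , _ , p∣xᵗ-1) , _) = ≈-mod (∣ᵤ⇒∣ (subst (p ∣_) (cong ℤ.∣_∣ (sym xᵗ-1≡)) p∣xᵗ-1))
    where
    xᵗ-1≡ : (+ x) ℤ.^ t ℤ.- 1ℤ ≡ + (x ^ t ∸ 1)
    xᵗ-1≡ = trans (cong (ℤ._- 1ℤ) (sym (pos-^ x t))) (+m-+n≡+[m∸n] (x ^ t) 1 (1≤m^n x t 1≤x))

  ratio-bounded : ∀ w → Bounded (ratio w)
  ratio-bounded w@(_ , x , (1≤x , x<p , _) , (a , b , 1≤b , b≤k , ∣a∣≤k , _) , _) =
    (≈b*x⇒1≤∣a∣ pp a b x 1≤b (ℕP.≤-<-trans b≤k k<p) 1≤x x<p (numerator≈ w) , ∣a∣≤k) , (1≤b , b≤k)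

  intHeight-residue : ∀ w → intHeight p (residue w) ≡ height w
  intHeight-residue (_ , _ , _ , _ , eq) = eq

  pointSignature : Point → Fin k → ℤ
  pointSignature w = signature P isP k (ratio w)

  equalSignature⇒equalHeight : ∀ w w′ → (∀ c → pointSignature w c ≡ pointSignature w′ c) → height w ≡ height w′
  equalSignature⇒equalHeight w@(_ , x , (1≤x , x<p , _) , (a , b , 1≤b , b≤k , _) , _)
                             w′@(_ , x′ , (1≤x′ , x′<p , _) , (a′ , b′ , 1≤b′ , b′≤k , _) , _) same =
    trans (sym (intHeight-residue w)) (trans heights≡ (intHeight-residue w′))
    where
    heights≡ : intHeight p x ≡ intHeight p x′
    heights≡ = equalRatio⇒equalHeight pp x x′ b b′ a a′ 1≤x x<p 1≤x′ x′<p 1≤b (ℕP.≤-<-trans b≤k k<p) 1≤b′ (ℕP.≤-<-trans b′≤k k<p)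
      (numerator≈ w) (numerator≈ w′)
      (equalSignature⇒equalRatio P isP k _ _ _ _ (ratio-bounded w) (ratio-bounded w′) same)

module Counting (P : ℕ → ℕ) (isP : IsPrimeEnum P) {p t k r s : ℕ} (pp : Prime p) (k<p : k < p)
  .{{_ : NonZero t}} .{{_ : NonZero k}} (small : 2 * (k ^ r * k ^ r) < p) (s₁ : IsS1 r t s)
  (L : List ℕ) (L! : Unique L) (L⊆V : All (InHeightSet p t k) L) where

  open CodeCount P isP k using (νdiff; Bounded; count≤Φ̃)
  open Points P isP p t k pp k<p

  points : List Point
  points = All.toList L⊆V

  length-points : length points ≡ length L
  length-points = trans (sym (LP.length-map proj₁ points)) (cong length (map-proj₁-toList L⊆V))

  points-distinct : AllPairs (λ w w′ → height w ≢ height w′) points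
  points-distinct = AllPairsP.map⁻ (subst (AllPairs _≢_) (sym (map-proj₁-toList L⊆V)) L!)

  open PivotBasis (pivotBasis k pointSignature points)

  rank≤s : rank ≤ s
  rank≤s = proj₂ s₁ rank binomial≤t
    where
    open CountRootsOfUnity pp t k r rank
      (λ i → residue (basis i)) (λ i → numerator (basis i)) (λ i → denominator (basis i))
      (λ i → residue-root (basis i)) (λ i → ≈-sym (numerator≈ (basis i)))
      (λ i → proj₂ (proj₁ (ratio-bounded (basis i)))) (λ i → proj₂ (proj₂ (ratio-bounded (basis i))))
      small
      (independentSignatures⇒monomial-injective P isP k _ _
        (λ i → proj₁ (proj₁ (ratio-bounded (basis i)))) (λ i → proj₁ (proj₂ (ratio-bounded (basis i))))
        independent)

  open AscendingCover (ascendingCover pivot) renaming (indices to ls)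

  -- Each signature is a rational combination of its pivot entries.
  pivots-determine-signature : ∀ u v → u ∈ points → v ∈ points →
    All (λ l → νdiff l (ratio u) ≡ νdiff l (ratio v)) ls → ∀ c → pointSignature u c ≡ pointSignature v c
  pivots-determine-signature u v u∈ v∈ same-on-ls c = ℤP.*-cancelˡ-≡ scale _ _ {{ℤ.≢-nonZero scale≢0}} (begin
    scale ℤ.* pointSignature u c                               ≡⟨ reconstruct u u∈ c ⟩
    sum (λ j → pointSignature u (pivot j) ℤ.* row j c)         ≡⟨ sum-cong-≗ (λ j → cong (ℤ._* row j c) (All.lookup same-on-ls (covers j))) ⟩
    sum (λ j → pointSignature v (pivot j) ℤ.* row j c)         ≡⟨ reconstruct v v∈ c ⟨
    scale ℤ.* pointSignature v c                               ∎)
    where open ≡-Reasoning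

  ratios-distinct-on-pivots : AllPairs (λ u v → ¬ All (λ l → νdiff l u ≡ νdiff l v) ls) (map ratio points)
  ratios-distinct-on-pivots = AllPairsP.map⁺ (AllPairs-mapWithAll
    (λ {u} {v} u∈ v∈ heights≢ same-on-ls → heights≢ (equalSignature⇒equalHeight u v (pivots-determine-signature u v u∈ v∈ same-on-ls)))
    (All.tabulate (λ u∈ → u∈)) points-distinct)

  length≤Φ̃ : length L ≤ Φ̃ P k s
  length≤Φ̃ = begin
    length L                      ≡⟨ trans (LP.length-map ratio points) length-points ⟨
    length (map ratio points)     ≤⟨ count≤Φ̃ ls ascending (map ratio points)
                                       (AllP.map⁺ (All.tabulate (λ {w} _ → ratio-bounded w))) ratios-distinct-on-pivots ⟩
    Φ̃ P k (length ls)             ≤⟨ Φ̃-mono P isP k 1≤k (ℕP.≤-trans length≤ rank≤s) ⟩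
    Φ̃ P k s                       ∎
    where
    open ℕP.≤-Reasoning
    1≤k = ℕ.>-nonZero⁻¹ k

k<2k² : ∀ {k} → 1 ≤ k → k < 2 * k ^ 2
k<2k² {suc k} _ = ℕP.≤-trans (ℕP.m≤m+n (suc (suc k)) _) (ℕP.≤-reflexive (sym (lem k)))
  where
  lem : ∀ k → 2 * ((1 + k) * ((1 + k) * 1)) ≡ (2 + k) + (k + 2 * (k * (1 + k)))
  lem = solve-∀

-- An odd prime is not twice anything.
2k^2r<p : ∀ {p} k r → Prime p → 2 < p → 2 * k ^ (2 * r) ≤ p → 2 * (k ^ r * k ^ r) < p
2k^2r<p {p} k r pp 2<p 2k^2r≤p = ℕP.≤∧≢⇒< 2k^2r≤p′ 2k^2r≢p
  where
  k^2r≡ : k ^ (2 * r) ≡ k ^ r * k ^ r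
  k^2r≡ = trans (cong (k ^_) (cong (_+_ r) (ℕP.+-identityʳ r))) (ℕP.^-distribˡ-+-* k r r)
  2k^2r≤p′ : 2 * (k ^ r * k ^ r) ≤ p
  2k^2r≤p′ = subst (λ z → 2 * z ≤ p) k^2r≡ 2k^2r≤p
  2k^2r≢p : 2 * (k ^ r * k ^ r) ≢ p
  2k^2r≢p eq = ℕP.<-irrefl (prime∣prime⇒≡ prime[2] pp (ℕD.divides (k ^ r * k ^ r) (trans (sym eq) (ℕP.*-comm 2 (k ^ r * k ^ r))))) 2<p

theorem1p6 : (P : ℕ → ℕ) → IsPrimeEnum P →
    (p t k r s : ℕ) → Prime p → 2 < p → 1 ≤ t → t ∣ p ∸ 1 →
    1 < k → 2 * k ^ 2 ≤ p → IsR1 p k r → IsS1 r t s →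
    (L : List ℕ) → Unique L → All (InHeightSet p t k) L →
    length L ≤ Φ̃ P k s
theorem1p6 P isP p t k r s pp 2<p 1≤t _ 1<k 2k²≤p r₁ s₁ L L! L⊆V =
  Counting.length≤Φ̃ P isP pp k<p {{ℕ.>-nonZero 1≤t}} {{ℕ.>-nonZero 1≤k}} (2k^2r<p k r pp 2<p (proj₁ r₁)) s₁ L L! L⊆V
  where
  1≤k = ℕP.<⇒≤ 1<k
  k<p = ℕP.<-≤-trans (k<2k² 1≤k) 2k²≤p
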